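{- Let $m \ge 2$ be even and $n \ge 4$ be even. The honeycomb toroidal graph $\mathrm{HTG}(m,n,2)$ is 2-spanning cyclable if and only if $(m,n) = (2,4)$, or $m \geq 4$ and $n \geq 6$.
   Context: For integers $m\ge 1$, $\ell\ge 0$ and $n\ge 4$ with $n$ even and $m-\ell$ even, the honeycomb toroidal graph $\mathrm{HTG}(m,n,\ell)$ is the simple graph with vertex set $\{u_{i,j}: 0\le i\le m-1,\ 0\le j\le n-1\}$ (first subscript computed modulo $m$, second modulo $n$) whose edge set is the set of the following unordered pairs: $\{u_{i,j},u_{i,j+1}\}$ for all $i,j$ (vertical edges); $\{u_{i,j},u_{i+1,j}\}$ for all $0\le i\le m-2$ with $i+j$ odd (flat edges); and $\{u_{m-1,j},u_{0,j+\ell}\}$ for all $j$ having the same parity as $m$ (and $\ell$) (jump edges). (Repeated pairs give a single edge.) A 2-factor of a graph is a spanning subgraph in which every vertex has valency 2. A graph $X$ is 2-spanning cyclable if for every pair of distinct vertices $u,v$ of $X$ there is a 2-factor of $X$ consisting of exactly two cycles such that $u$ and $v$ lie in different cycles. -}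

module Defs where

open import Data.Nat using (ℕ; zero; suc; _+_; _*_; _∸_; _%_)
open import Data.Fin using (Fin; toℕ)
open import Data.Product using (Σ; ∃; _×_; _,_)
open import Data.Sum using (_⊎_)
open import Relation.Binary.PropositionalEquality using (_≡_; _≢_)
open import Relation.Nullary using (¬_)
open import Relation.Binary.Construct.Closure.ReflexiveTransitive using (Star)

-- Vertex u_{i,j} of HTG(m,n,ℓ) is the pair (i , j).
Vertex : ℕ → ℕ → Set
Vertex m n = Fin m × Fin n

-- b is the residue of (a + k) modulo n  (b is given as an element of Fin n,
-- so b < n; the existence of q forces b = (a + k) mod n).
ShiftMod : (n a k b : ℕ) → Set
ShiftMod n a k b = ∃ λ q → a + k ≡ b + q * n

-- Directed "generator" edges of HTG(m,n,ℓ), from the definition: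
--  vertical: u_{i,j} -- u_{i,j+1}
--  flat:     u_{i,j} -- u_{i+1,j},  0 ≤ i ≤ m-2,  i+j odd
--  jump:     u_{m-1,j} -- u_{0,j+ℓ}, j ≡ m (mod 2)
data Gen (m n ℓ : ℕ) : Vertex m n → Vertex m n → Set where
  vertical : ∀ i j j' → ShiftMod n (toℕ j) 1 (toℕ j') →
             Gen m n ℓ (i , j) (i , j')
  flat     : ∀ i i' j → toℕ i' ≡ suc (toℕ i) → (toℕ i + toℕ j) % 2 ≡ 1 →
             Gen m n ℓ (i , j) (i' , j)
  jump     : ∀ i i' j j' → suc (toℕ i) ≡ m → toℕ i' ≡ 0 →
             toℕ j % 2 ≡ m % 2 → ShiftMod n (toℕ j) ℓ (toℕ j') →
             Gen m n ℓ (i , j) (i' , j')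

Adj : (m n ℓ : ℕ) → Vertex m n → Vertex m n → Set
Adj m n ℓ x y = x ≢ y × (Gen m n ℓ x y ⊎ Gen m n ℓ y x)

Is2Factor : {V : Set} → (A F : V → V → Set) → Set
Is2Factor {V} A F =
  (∀ x y → F x y → A x y) ×
  (∀ x y → F x y → F y x) ×
  (∀ x → Σ V λ a → Σ V λ b →
         a ≢ b × F x a × F x b × (∀ c → F x c → c ≡ a ⊎ c ≡ b))

-- X is 2-spanning cyclable: for all distinct u v there is a 2-factor with
-- exactly two cycles (components), u and v in different ones.  Here:
-- u, v are not connected in F and every vertex is connected (in F) to u or
-- to v; hence F has exactly two components (cycles) separating u and v.
TwoSpanningCyclable : (V : Set) → (V → V → Set) → Set₁
TwoSpanningCyclable V A =
  ∀ (u v : V) → u ≢ v →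
  Σ (V → V → Set) λ F →
    Is2Factor A F ×
    ¬ Star F u v ×
    (∀ w → Star F u w ⊎ Star F v w)

HTG-2SC : (m n ℓ : ℕ) → Set₁
HTG-2SC m n ℓ = TwoSpanningCyclable (Vertex m n) (Adj m n ℓ)

{-# OPTIONS --safe #-}
-- HTG(m, n, 2) is cubic, so its 2-factors are the complements of perfect matchings, and such a
-- 2-factor has exactly two cycles separating u from v as soon as some Boolean function on the
-- vertices is constant along its edges, differs on u and v, and has connected value classes.
-- For (m , n) = (2 , 4) three matchings separate every pair of vertices.  For m ≥ 4 and n ≥ 6 one
-- matching leaves a hexagon and a single long cycle; the translations of the graph carry any vertex u
-- to (1 , 3) or (1 , 4) and then bring u and v to different sides of the hexagon.
-- For m = 2 or n = 4 the graph is a closed ladder of 4-cycles.  A 2-factor separating the two ends of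
-- a rung either has two neighbouring squares as cycles, which leaves the other vertices uncovered,
-- or its cycle through one end is forced around the whole ladder back to the other end.
module Submission where

open import Defs
open import Data.Nat using (ℕ; zero; suc; _+_; _*_; _∸_; _%_; NonZero; _≤_; _<_; z≤n; s≤s; s≤s⁻¹; _≟_; _<?_)
open import Data.Nat.Properties
open import Data.Nat.DivMod using (_mod_; _/_; m<n⇒m%n≡m; [m+kn]%n≡m%n; m≡m%n+[m/n]*n; m%n<n; m%n%n≡m%n; n%n≡0; [m+n]%n≡m%n; %-distribˡ-+)
open import Data.Fin using (Fin; toℕ; fromℕ<; fromℕ; inject₁) renaming (zero to fz; suc to fs)
import Data.Fin.Properties as Fin
open import Data.Fin.Patterns using (0F; 1F; 2F; 3F; 4F; 5F)
open import Data.Bool using (Bool; true; false; not; _xor_; if_then_else_)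
import Data.Bool as Bool
open import Data.Bool.Properties using (not-involutive; not-distribˡ-xor; not-distribʳ-xor; xor-comm; xor-assoc; xor-same; ¬-not)
open import Data.Product using (Σ; ∃; _×_; _,_; proj₁; proj₂)
open import Data.Sum using (_⊎_; inj₁; inj₂)
import Data.Sum as Sum
open import Data.Empty using (⊥; ⊥-elim)
open import Function using (_∘_; flip)
open import Function.Bundles using (_⇔_; mk⇔)
open import Relation.Nullary using (¬_; Dec; yes; no; contradiction)
open import Relation.Binary.PropositionalEquality
open import Relation.Binary.Construct.Closure.ReflexiveTransitive

odd : ℕ → Bool
odd zero = false
odd (suc k) = not (odd k)

odd-+ : ∀ a b → odd (a + b) ≡ odd a xor odd b
odd-+ zero b = refl
odd-+ (suc a) b rewrite odd-+ a b = not-distribˡ-xor (odd a) (odd b)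

odd-suc-suc : ∀ k → odd (suc (suc k)) ≡ odd k
odd-suc-suc k = not-involutive (odd k)

odd-*-even : ∀ k {n} → odd n ≡ false → odd (k * n) ≡ false
odd-*-even zero _ = refl
odd-*-even (suc k) {n} n-even = trans (odd-+ n (k * n)) (cong₂ _xor_ n-even (odd-*-even k n-even))

odd-sandwich : ∀ k j → odd (k + (j + k)) ≡ odd j
odd-sandwich k j = begin
  odd (k + (j + k))              ≡⟨ odd-+ k (j + k) ⟩
  odd k xor odd (j + k)          ≡⟨ cong (odd k xor_) (trans (odd-+ j k) (xor-comm (odd j) (odd k))) ⟩
  odd k xor (odd k xor odd j)    ≡⟨ xor-assoc (odd k) (odd k) (odd j) ⟨
  (odd k xor odd k) xor odd j    ≡⟨ cong (_xor odd j) (xor-same (odd k)) ⟩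
  odd j                          ∎
  where open ≡-Reasoning

double : ℕ → ℕ
double zero = zero
double (suc s) = suc (suc (double s))

odd-double : ∀ s → odd (double s) ≡ false
odd-double zero = refl
odd-double (suc s) = trans (odd-suc-suc (double s)) (odd-double s)

double-mono : ∀ {s t} → s ≤ t → double s ≤ double t
double-mono z≤n = z≤n
double-mono (s≤s s≤t) = s≤s (s≤s (double-mono s≤t))

double-cancel : ∀ {s t} → double s ≤ suc (double t) → s ≤ t
double-cancel {zero} _ = z≤n
double-cancel {suc s} {zero} (s≤s ())
double-cancel {suc s} {suc t} (s≤s (s≤s h)) = s≤s (double-cancel h)

parity-split : ∀ k → ∃ λ s → k ≡ double s ⊎ k ≡ suc (double s)
parity-split zero = zero , inj₁ refl
parity-split (suc zero) = zero , inj₂ refl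
parity-split (suc (suc k)) with parity-split k
... | s , inj₁ refl = suc s , inj₁ refl
... | s , inj₂ refl = suc s , inj₂ refl

-- Separating 2-factors, and matchings in cubic graphs

Separating2Factor : {V : Set} → (V → V → Set) → V → V → Set₁
Separating2Factor {V} A u v =
  Σ (V → V → Set) λ F → Is2Factor A F × ¬ Star F u v × (∀ w → Star F u w ⊎ Star F v w)

module _ {V : Set} {A : V → V → Set} where

  separating-by-invariant : (F : V → V → Set) → Is2Factor A F → (S : V → Bool) →
    (∀ {x y} → F x y → S x ≡ S y) → (base : Bool → V) → (∀ w → Star F (base (S w)) w) →
    ∀ {u v} → S u ≢ S v → Separating2Factor A u v
  separating-by-invariant F F-2factor@(_ , F-sym , _) S S-invariant base connected {u} {v} Su≢Sv =
    F , F-2factor , (λ u~v → Su≢Sv (invariant u~v)) , cover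
    where
      invariant : ∀ {x y} → Star F x y → S x ≡ S y
      invariant ε = refl
      invariant (f ◅ p) = trans (S-invariant f) (invariant p)

      from : ∀ x {w} → S w ≡ S x → Star F x w
      from x {w} Sw≡Sx = reverse (λ {a} {b} → F-sym a b) (connected x) ◅◅ subst (λ b → Star F (base b) w) Sw≡Sx (connected w)

      cover : ∀ w → Star F u w ⊎ Star F v w
      cover w with S w Bool.≟ S u
      ... | yes Sw≡Su = inj₁ (from u Sw≡Su)
      ... | no Sw≢Su = inj₂ (from v (trans (¬-not Sw≢Su) (sym (¬-not (λ e → Su≢Sv (sym e))))))

  Separating2Factor-transport : (f g : V → V) → (∀ x → g (f x) ≡ x) → (∀ x → f (g x) ≡ x) →
    (∀ {x y} → A x y → A (f x) (f y)) → ∀ {u v} → Separating2Factor A u v → Separating2Factor A (f u) (f v)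
  Separating2Factor-transport f g gf fg f-adj {u} {v} (F , (F⊆A , F-sym , F-deg) , u≁v , cover) =
    F′ , (F′⊆A , (λ x y → F-sym (g x) (g y)) , F′-deg) , u≁v′ , cover′
    where
      F′ : V → V → Set
      F′ x y = F (g x) (g y)

      F→F′ : ∀ {x y} → F x y → F′ (f x) (f y)
      F→F′ {x} {y} = subst₂ F (sym (gf x)) (sym (gf y))

      F′⊆A : ∀ x y → F′ x y → A x y
      F′⊆A x y e = subst₂ A (fg x) (fg y) (f-adj (F⊆A (g x) (g y) e))

      F′-deg : ∀ x → Σ V λ a → Σ V λ b →
               a ≢ b × F′ x a × F′ x b × (∀ c → F′ x c → c ≡ a ⊎ c ≡ b)
      F′-deg x with F-deg (g x)
      ... | a , b , a≢b , xa , xb , only =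
        f a , f b , (λ e → a≢b (trans (sym (gf a)) (trans (cong g e) (gf b)))) ,
        subst (F (g x)) (sym (gf a)) xa , subst (F (g x)) (sym (gf b)) xb ,
        λ c xc → Sum.map (λ e → trans (sym (fg c)) (cong f e)) (λ e → trans (sym (fg c)) (cong f e)) (only (g c) xc)

      u≁v′ : ¬ Star F′ (f u) (f v)
      u≁v′ p = u≁v (subst₂ (Star F) (gf u) (gf v) (gmap g (λ e → e) p))

      cover′ : ∀ w → Star F′ (f u) w ⊎ Star F′ (f v) w
      cover′ w = Sum.map (λ p → subst (Star F′ (f u)) (fg w) (gmap f F→F′ p))
                         (λ p → subst (Star F′ (f v)) (fg w) (gmap f F→F′ p)) (cover (g w))

module _ {V : Set} {F : V → V → Set} (F-sym : ∀ {x y} → F x y → F y x) where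

  zigzag-connected : (x y : ℕ → V) (k : ℕ) → (∀ c → c ≤ k → Star F (x c) (y c)) →
    (∀ c → c < k → Star F (x c) (x (suc c)) ⊎ Star F (y c) (y (suc c))) →
    ∀ c → c ≤ k → Star F (x 0) (x c) × Star F (x 0) (y c)
  zigzag-connected x y k rung rail zero _ = ε , rung 0 z≤n
  zigzag-connected x y k rung rail (suc c) c<k
    with zigzag-connected x y k rung rail c (≤-trans (n≤1+n c) c<k) | rail c c<k
  ... | x₀xc , x₀yc | inj₁ xx = x₀xc ◅◅ xx , x₀xc ◅◅ xx ◅◅ rung (suc c) c<k
  ... | x₀xc , x₀yc | inj₂ yy = x₀yc ◅◅ yy ◅◅ reverse F-sym (rung (suc c) c<k) , x₀yc ◅◅ yy

data Dir : Set where
  ↑ ↓ ⇄ : Dir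

opp : Dir → Dir
opp ↑ = ↓
opp ↓ = ↑
opp ⇄ = ⇄

opp-involutive : ∀ d → opp (opp d) ≡ d
opp-involutive ↑ = refl
opp-involutive ↓ = refl
opp-involutive ⇄ = refl

other₁ other₂ : Dir → Dir
other₁ ↑ = ↓
other₁ ↓ = ⇄
other₁ ⇄ = ↑
other₂ ↑ = ⇄
other₂ ↓ = ↑
other₂ ⇄ = ↓

other₁≢ : ∀ d → other₁ d ≢ d
other₁≢ ↑ ()
other₁≢ ↓ ()
other₁≢ ⇄ ()

other₂≢ : ∀ d → other₂ d ≢ d
other₂≢ ↑ ()
other₂≢ ↓ ()
other₂≢ ⇄ ()

other₁≢other₂ : ∀ d → other₁ d ≢ other₂ d
other₁≢other₂ ↑ ()
other₁≢other₂ ↓ ()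
other₁≢other₂ ⇄ ()

others-cover : ∀ {d e} → e ≢ d → e ≡ other₁ d ⊎ e ≡ other₂ d
others-cover {↑} {↑} e≢d = contradiction refl e≢d
others-cover {↑} {↓} _ = inj₁ refl
others-cover {↑} {⇄} _ = inj₂ refl
others-cover {↓} {↑} _ = inj₂ refl
others-cover {↓} {↓} e≢d = contradiction refl e≢d
others-cover {↓} {⇄} _ = inj₁ refl
others-cover {⇄} {↑} _ = inj₁ refl
others-cover {⇄} {↓} _ = inj₂ refl
others-cover {⇄} {⇄} e≢d = contradiction refl e≢d

_≟-Dir_ : (d e : Dir) → Dec (d ≡ e)
↑ ≟-Dir ↑ = yes refl
↑ ≟-Dir ↓ = no λ ()
↑ ≟-Dir ⇄ = no λ ()
↓ ≟-Dir ↑ = no λ ()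
↓ ≟-Dir ↓ = yes refl
↓ ≟-Dir ⇄ = no λ ()
⇄ ≟-Dir ↑ = no λ ()
⇄ ≟-Dir ↓ = no λ ()
⇄ ≟-Dir ⇄ = yes refl

distinct-dirs-cover : ∀ {a b c} → a ≢ b → a ≢ c → b ≢ c → ∀ d → d ≡ a ⊎ d ≡ b ⊎ d ≡ c
distinct-dirs-cover {a} a≢b a≢c b≢c d with d ≟-Dir a
... | yes d≡a = inj₁ d≡a
... | no d≢a with others-cover d≢a | others-cover (a≢b ∘ sym) | others-cover (a≢c ∘ sym)
...   | inj₁ refl | inj₁ refl | _ = inj₂ (inj₁ refl)
...   | inj₁ refl | inj₂ refl | inj₁ refl = inj₂ (inj₂ refl)
...   | inj₁ refl | inj₂ refl | inj₂ refl = contradiction refl b≢c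
...   | inj₂ refl | inj₂ refl | _ = inj₂ (inj₁ refl)
...   | inj₂ refl | inj₁ refl | inj₂ refl = inj₂ (inj₂ refl)
...   | inj₂ refl | inj₁ refl | inj₁ refl = contradiction refl b≢c

module CubicGraph {V : Set} (A : V → V → Set) (nbr : V → Dir → V)
  (nbr-adj : ∀ x d → A x (nbr x d))
  (adj⇒nbr : ∀ {x y} → A x y → ∃ λ d → y ≡ nbr x d)
  (nbr-injective : ∀ x {d e} → nbr x d ≡ nbr x e → d ≡ e)
  (A-sym : ∀ {x y} → A x y → A y x) where

  partner : (V → Dir) → V → V
  partner μ x = nbr x (μ x)

  record IsPerfectMatching (μ : V → Dir) : Set where
    constructor perfect-matching
    field partner-involutive : ∀ x → partner μ (partner μ x) ≡ x

  Unmatched : (V → Dir) → V → V → Set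
  Unmatched μ x y = A x y × y ≢ partner μ x

  module _ {μ : V → Dir} where

    unmatched-step : ∀ x d → d ≢ μ x → Unmatched μ x (nbr x d)
    unmatched-step x d d≢μx = nbr-adj x d , d≢μx ∘ nbr-injective x

    unmatched-dir : ∀ {x y} → Unmatched μ x y → ∃ λ d → d ≢ μ x × y ≡ nbr x d
    unmatched-dir {x} (xy , y≢partner) with adj⇒nbr xy
    ... | d , refl = d , (λ d≡μx → y≢partner (cong (nbr x) d≡μx)) , refl

    unmatched-invariant : (S : V → Bool) → (∀ x d → d ≢ μ x → S (nbr x d) ≡ S x) →
                          ∀ {x y} → Unmatched μ x y → S x ≡ S y
    unmatched-invariant S S-stable {x} xy with unmatched-dir xy
    ... | d , d≢μx , refl = sym (S-stable x d d≢μx)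

    unmatched-2factor : IsPerfectMatching μ → Is2Factor A (Unmatched μ)
    unmatched-2factor (perfect-matching involutive) = (λ _ _ → proj₁) , symmetric , degree
      where
        symmetric : ∀ x y → Unmatched μ x y → Unmatched μ y x
        symmetric x y (xy , y≢partner) =
          A-sym xy , λ x≡partner → y≢partner (trans (sym (involutive y)) (cong (partner μ) (sym x≡partner)))

        degree : ∀ x → Σ V λ a → Σ V λ b → a ≢ b × Unmatched μ x a × Unmatched μ x b ×
                 (∀ c → Unmatched μ x c → c ≡ a ⊎ c ≡ b)
        degree x =
          nbr x (other₁ (μ x)) , nbr x (other₂ (μ x)) ,
          (λ e → other₁≢other₂ (μ x) (nbr-injective x e)) ,
          unmatched-step x _ (other₁≢ (μ x)) , unmatched-step x _ (other₂≢ (μ x)) , only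
          where
            only : ∀ c → Unmatched μ x c → c ≡ nbr x (other₁ (μ x)) ⊎ c ≡ nbr x (other₂ (μ x))
            only c xc with unmatched-dir xc
            ... | d , d≢μx , refl = Sum.map (cong (nbr x)) (cong (nbr x)) (others-cover d≢μx)

    stable-from-others : (S : V → Bool) →
      (∀ x → S (nbr x (other₁ (μ x))) ≡ S x × S (nbr x (other₂ (μ x))) ≡ S x) →
      ∀ x d → d ≢ μ x → S (nbr x d) ≡ S x
    stable-from-others S stable x d d≢μx with others-cover d≢μx
    ... | inj₁ refl = proj₁ (stable x)
    ... | inj₂ refl = proj₂ (stable x)

    unmatched-separating : IsPerfectMatching μ → (S : V → Bool) → (∀ x d → d ≢ μ x → S (nbr x d) ≡ S x) →
      (base : Bool → V) → (∀ w → Star (Unmatched μ) (base (S w)) w) →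
      ∀ {u v} → S u ≢ S v → Separating2Factor A u v
    unmatched-separating perfect S stable =
      separating-by-invariant (Unmatched μ) (unmatched-2factor perfect) S (unmatched-invariant S stable)

    closed-from-inside : IsPerfectMatching μ → (S : V → Bool) →
      (∀ x → S x ≡ true → S (nbr x (other₁ (μ x))) ≡ true × S (nbr x (other₂ (μ x))) ≡ true) →
      ∀ x d → d ≢ μ x → S (nbr x d) ≡ S x
    closed-from-inside perfect S inside = stable
      where
        inside-step : ∀ y d → S y ≡ true → d ≢ μ y → S (nbr y d) ≡ true
        inside-step y d Sy d≢μy with others-cover d≢μy
        ... | inj₁ refl = proj₁ (inside y Sy)
        ... | inj₂ refl = proj₂ (inside y Sy)

        -- An unmatched edge entering S from outside would, read backwards, leave S.
        stable : ∀ x d → d ≢ μ x → S (nbr x d) ≡ S x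
        stable x d d≢μx with S x in Sx
        ... | true = inside-step x d Sx d≢μx
        ... | false with S (nbr x d) in Sy
        ...   | false = refl
        ...   | true with unmatched-dir (proj₁ (proj₂ (unmatched-2factor perfect)) x (nbr x d) (unmatched-step x d d≢μx))
        ...     | d′ , d′≢ , x≡ = contradiction (trans (sym Sx) (trans (cong S x≡) (inside-step _ d′ Sy d′≢))) λ ()

-- Closed ladders of 4-cycles

module _ {V : Set} (A : V → V → Set) where

  record Neighbours (x a b c : V) : Set where
    constructor neighbours
    field
      only : ∀ {y} → A x y → y ≡ a ⊎ y ≡ b ⊎ y ≡ c
      a≢b : a ≢ b
      a≢c : a ≢ c
      b≢c : b ≢ c

  record Square : Set where
    field
      p q r s p′ q′ r′ s′ : V
      p-nbrs : Neighbours p q s p′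
      q-nbrs : Neighbours q p r q′
      r-nbrs : Neighbours r q s r′
      s-nbrs : Neighbours s r p s′

module _ {V : Set} {A : V → V → Set} where

  Neighbours-swap : ∀ {x a b c} → Neighbours A x a b c → Neighbours A x b a c
  Neighbours-swap N = record
    { only = λ xy → swap₁₂ (only xy) ; a≢b = λ e → a≢b (sym e) ; a≢c = b≢c ; b≢c = a≢c }
    where
      open Neighbours N
      swap₁₂ : ∀ {y a b c : V} → y ≡ a ⊎ y ≡ b ⊎ y ≡ c → y ≡ b ⊎ y ≡ a ⊎ y ≡ c
      swap₁₂ (inj₁ e) = inj₂ (inj₁ e)
      swap₁₂ (inj₂ (inj₁ e)) = inj₁ e
      swap₁₂ (inj₂ (inj₂ e)) = inj₂ (inj₂ e)

  Neighbours-rotate : ∀ {x a b c} → Neighbours A x a b c → Neighbours A x b c a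
  Neighbours-rotate N = record
    { only = λ xy → rotate₃ (only xy) ; a≢b = b≢c ; a≢c = λ e → a≢b (sym e) ; b≢c = λ e → a≢c (sym e) }
    where
      open Neighbours N
      rotate₃ : ∀ {y a b c : V} → y ≡ a ⊎ y ≡ b ⊎ y ≡ c → y ≡ b ⊎ y ≡ c ⊎ y ≡ a
      rotate₃ (inj₁ e) = inj₂ (inj₂ e)
      rotate₃ (inj₂ e) = Sum.map₂ inj₁ e

  rotate : Square A → Square A
  rotate b = record
    { p = q ; q = r ; r = s ; s = p ; p′ = q′ ; q′ = r′ ; r′ = s′ ; s′ = p′
    ; p-nbrs = Neighbours-swap q-nbrs ; q-nbrs = r-nbrs ; r-nbrs = s-nbrs ; s-nbrs = Neighbours-swap p-nbrs }
    where open Square b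

  record Rungs (b c : Square A) : Set where
    field
      q′≡p : Square.q′ b ≡ Square.p c
      p′≡q : Square.p′ c ≡ Square.q b
      s′≡r : Square.s′ b ≡ Square.r c
      r′≡s : Square.r′ c ≡ Square.s b

  _∈□_ : V → Square A → Set
  x ∈□ b = x ≡ p ⊎ x ≡ q ⊎ x ≡ r ⊎ x ≡ s
    where open Square b

  module Within2Factor (F : V → V → Set) (F-2factor : Is2Factor A F) where

    private
      F⊆A : ∀ x y → F x y → A x y
      F⊆A = proj₁ F-2factor

    data OneUnused (x a b c : V) : Set where
      unused-a : ¬ F x a → F x b → F x c → OneUnused x a b c
      unused-b : F x a → ¬ F x b → F x c → OneUnused x a b c
      unused-c : F x a → F x b → ¬ F x c → OneUnused x a b c

    unused-unless : ∀ {x y₁ y₂ z} → (F x z → z ≡ y₁ ⊎ z ≡ y₂) → y₁ ≢ z → y₂ ≢ z → ¬ F x z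
    unused-unless two y₁≢z y₂≢z xz = Sum.[ (λ e → y₁≢z (sym e)) , (λ e → y₂≢z (sym e)) ] (two xz)

    one-unused : ∀ {x a b c} → Neighbours A x a b c → OneUnused x a b c
    one-unused {x} (neighbours only a≢b a≢c b≢c) with proj₂ (proj₂ F-2factor) x
    ... | y₁ , y₂ , y₁≢y₂ , xy₁ , xy₂ , two with only (F⊆A x y₁ xy₁) | only (F⊆A x y₂ xy₂)
    ... | inj₁ refl | inj₁ refl = contradiction refl y₁≢y₂
    ... | inj₁ refl | inj₂ (inj₁ refl) = unused-c xy₁ xy₂ (unused-unless (two _) a≢c b≢c)
    ... | inj₁ refl | inj₂ (inj₂ refl) = unused-b xy₁ (unused-unless (two _) a≢b (≢-sym b≢c)) xy₂
    ... | inj₂ (inj₁ refl) | inj₁ refl = unused-c xy₂ xy₁ (unused-unless (two _) b≢c a≢c)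
    ... | inj₂ (inj₁ refl) | inj₂ (inj₁ refl) = contradiction refl y₁≢y₂
    ... | inj₂ (inj₁ refl) | inj₂ (inj₂ refl) = unused-a (unused-unless (two _) (≢-sym a≢b) (≢-sym a≢c)) xy₁ xy₂
    ... | inj₂ (inj₂ refl) | inj₁ refl = unused-b xy₂ (unused-unless (two _) (≢-sym b≢c) a≢b) xy₁
    ... | inj₂ (inj₂ refl) | inj₂ (inj₁ refl) = unused-a (unused-unless (two _) (≢-sym a≢c) (≢-sym a≢b)) xy₂ xy₁
    ... | inj₂ (inj₂ refl) | inj₂ (inj₂ refl) = contradiction refl y₁≢y₂

    F-sym′ : ∀ {x y} → F x y → F y x
    F-sym′ {x} {y} = proj₁ (proj₂ F-2factor) x y

    uses-others : ∀ {x a b c} → Neighbours A x a b c → ¬ F x c → F x a × F x b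
    uses-others N ¬xc with one-unused N
    ... | unused-a _ _ xc = contradiction xc ¬xc
    ... | unused-b _ _ xc = contradiction xc ¬xc
    ... | unused-c xa xb _ = xa , xb

    third-unused : ∀ {x a b c} → Neighbours A x a b c → F x a → F x b → ¬ F x c
    third-unused N xa xb with one-unused N
    ... | unused-a ¬xa _ _ = contradiction xa ¬xa
    ... | unused-b _ ¬xb _ = contradiction xb ¬xb
    ... | unused-c _ _ ¬xc = ¬xc

    module _ (b : Square A) where
      open Square b

      outer-unused : ¬ F p p′ → ¬ F r r′ → ¬ F q q′ × ¬ F s s′
      outer-unused ¬pp′ ¬rr′ with uses-others p-nbrs ¬pp′ | uses-others r-nbrs ¬rr′
      ... | pq , ps | rq , rs =
        third-unused q-nbrs (F-sym′ pq) (F-sym′ rq) , third-unused s-nbrs (F-sym′ rs) (F-sym′ ps)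

      isolated : ¬ F p p′ → ¬ F q q′ → ¬ F r r′ → ¬ F s s′ →
                 ∀ {x y} → Star F x y → x ∈□ b → y ∈□ b
      isolated ¬pp′ ¬qq′ ¬rr′ ¬ss′ ε x∈b = x∈b
      isolated ¬pp′ ¬qq′ ¬rr′ ¬ss′ (xy ◅ path) x∈b =
        isolated ¬pp′ ¬qq′ ¬rr′ ¬ss′ path (step x∈b xy)
        where
          step : ∀ {x y} → x ∈□ b → F x y → y ∈□ b
          step (inj₁ refl) xy with Neighbours.only p-nbrs (F⊆A _ _ xy)
          ... | inj₁ e = inj₂ (inj₁ e)
          ... | inj₂ (inj₁ e) = inj₂ (inj₂ (inj₂ e))
          ... | inj₂ (inj₂ refl) = contradiction xy ¬pp′
          step (inj₂ (inj₁ refl)) xy with Neighbours.only q-nbrs (F⊆A _ _ xy)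
          ... | inj₁ e = inj₁ e
          ... | inj₂ (inj₁ e) = inj₂ (inj₂ (inj₁ e))
          ... | inj₂ (inj₂ refl) = contradiction xy ¬qq′
          step (inj₂ (inj₂ (inj₁ refl))) xy with Neighbours.only r-nbrs (F⊆A _ _ xy)
          ... | inj₁ e = inj₂ (inj₁ e)
          ... | inj₂ (inj₁ e) = inj₂ (inj₂ (inj₂ e))
          ... | inj₂ (inj₂ refl) = contradiction xy ¬rr′
          step (inj₂ (inj₂ (inj₂ refl))) xy with Neighbours.only s-nbrs (F⊆A _ _ xy)
          ... | inj₁ e = inj₂ (inj₂ (inj₁ e))
          ... | inj₂ (inj₁ e) = inj₁ e
          ... | inj₂ (inj₂ refl) = contradiction xy ¬ss′

      data Exit : Set where
        exit-q : F q q′ → ¬ F s s′ → Exit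
        exit-s : F s s′ → ¬ F q q′ → Exit

      traverse : F p p′ → ¬ F r r′ → Exit × Star F p q × Star F p s
      traverse pp′ ¬rr′ with one-unused p-nbrs | uses-others r-nbrs ¬rr′
      ... | unused-a ¬pq ps _ | rq , rs =
            exit-q (proj₂ (uses-others (Neighbours-rotate q-nbrs) (¬pq ∘ F-sym′)))
                   (third-unused s-nbrs (F-sym′ rs) (F-sym′ ps)) ,
            ps ◅ F-sym′ rs ◅ rq ◅ ε , ps ◅ ε
      ... | unused-b pq ¬ps _ | rq , rs =
            exit-s (proj₁ (uses-others (Neighbours-rotate (Neighbours-rotate s-nbrs)) (¬ps ∘ F-sym′)))
                   (third-unused q-nbrs (F-sym′ pq) (F-sym′ rq)) ,
            pq ◅ ε , pq ◅ F-sym′ rq ◅ rs ◅ ε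
      ... | unused-c _ _ ¬pp′ | _ = contradiction pp′ ¬pp′

    data Entered (v : V) (b : Square A) : Set where
      via-p : F (Square.p b) (Square.p′ b) → ¬ F (Square.r b) (Square.r′ b) → Star F v (Square.p b) → Entered v b
      via-r : F (Square.r b) (Square.r′ b) → ¬ F (Square.p b) (Square.p′ b) → Star F v (Square.r b) → Entered v b

    module _ {v : V} {b : Square A} where
      open Square b

      entered-exit : Entered v b → Exit b
      entered-exit (via-p pp′ ¬rr′ _) = proj₁ (traverse b pp′ ¬rr′)
      entered-exit (via-r rr′ ¬pp′ _) with proj₁ (traverse (rotate (rotate b)) rr′ ¬pp′)
      ... | exit-q ss′ ¬qq′ = exit-s ss′ ¬qq′
      ... | exit-s qq′ ¬ss′ = exit-q qq′ ¬ss′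

      entered-reaches : Entered v b → Star F v q × Star F v s
      entered-reaches (via-p pp′ ¬rr′ vp) =
        let (_ , pq , ps) = traverse b pp′ ¬rr′ in vp ◅◅ pq , vp ◅◅ ps
      entered-reaches (via-r rr′ ¬pp′ vr) =
        let (_ , rs , rq) = traverse (rotate (rotate b)) rr′ ¬pp′ in vr ◅◅ rq , vr ◅◅ rs

    rung : ∀ {x x′ y y′} → x′ ≡ y → y′ ≡ x → F x x′ → F y y′
    rung {x} {y = y} x′≡y y′≡x xx′ = subst (F y) (sym y′≡x) (F-sym′ (subst (F x) x′≡y xx′))

    entered-next : ∀ {v b c} → Rungs b c → Entered v b → Entered v c
    entered-next {b = b} record { q′≡p = q′≡p ; p′≡q = p′≡q ; s′≡r = s′≡r ; r′≡s = r′≡s } entered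
      with entered-exit entered | entered-reaches entered
    ... | exit-q qq′ ¬ss′ | vq , _ =
          via-p (rung q′≡p p′≡q qq′) (¬ss′ ∘ rung r′≡s s′≡r) (vq ◅◅ subst (F (Square.q b)) q′≡p qq′ ◅ ε)
    ... | exit-s ss′ ¬qq′ | _ , vs =
          via-r (rung s′≡r r′≡s ss′) (¬qq′ ∘ rung p′≡q q′≡p) (vs ◅◅ subst (F (Square.s b)) s′≡r ss′ ◅ ε)

  module LadderArgument (sq : ℕ → Square A) (K : ℕ) (rungs : ∀ k → k ≤ K → Rungs (sq k) (sq (suc k)))
    (last : Square A) (closing : Rungs (sq (suc K)) last)
    (F : V → V → Set) (F-2factor : Is2Factor A F)
    (u≁v : ¬ Star F (Square.s (sq 0)) (Square.r (sq 1)))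
    (cover : ∀ w → Star F (Square.s (sq 0)) w ⊎ Star F (Square.r (sq 1)) w) where

    open Square
    open Within2Factor F F-2factor
    private
      u v : V
      u = s (sq 0)
      v = r (sq 1)
      open Rungs (rungs 0 z≤n)

    rung-uv-unused : ¬ F v (r′ (sq 1))
    rung-uv-unused vr′ = u≁v (F-sym′ (subst (F v) r′≡s vr′) ◅ ε)

    entered-from-v : F (p (sq 1)) (p′ (sq 1)) → ∀ k → k ≤ K → Entered v (sq (suc k))
    entered-from-v pp′ zero _ = via-p pp′ rung-uv-unused (rq ◅ reverse F-sym′ pq)
      where
        pq : Star F (p (sq 1)) (q (sq 1))
        pq = proj₁ (proj₂ (traverse (sq 1) pp′ rung-uv-unused))
        rq : F (r (sq 1)) (q (sq 1))
        rq = proj₁ (uses-others (r-nbrs (sq 1)) rung-uv-unused)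
    entered-from-v pp′ (suc k) k<K = entered-next (rungs (suc k) k<K) (entered-from-v pp′ k (≤-trans (n≤1+n k) k<K))

    around : F (p (sq 1)) (p′ (sq 1)) → u ≡ s last ⊎ u ≡ q last → ⊥
    around pp′ closes = u≁v (reverse F-sym′ (Sum.[ (λ e → subst (Star F v) (sym e) vs) , (λ e → subst (Star F v) (sym e) vq) ] closes))
      where
        entered-last : Entered v last
        entered-last = entered-next closing (entered-from-v pp′ K ≤-refl)
        vq : Star F v (q last)
        vq = proj₁ (entered-reaches entered-last)
        vs : Star F v (s last)
        vs = proj₂ (entered-reaches entered-last)

    squares-isolated : ¬ F (p (sq 1)) (p′ (sq 1)) → ∀ w → w ∈□ sq 0 ⊎ w ∈□ sq 1
    squares-isolated ¬pp′₁ w =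
      Sum.map (λ uw → isolated (sq 0) ¬pp′₀ ¬qq′₀ ¬rr′₀ ¬ss′₀ uw (inj₂ (inj₂ (inj₂ refl))))
              (λ vw → isolated (sq 1) ¬pp′₁ ¬qq′₁ rung-uv-unused ¬ss′₁ vw (inj₂ (inj₂ (inj₁ refl))))
              (cover w)
      where
        ¬qq′₁ : ¬ F (q (sq 1)) (q′ (sq 1))
        ¬qq′₁ = proj₁ (outer-unused (sq 1) ¬pp′₁ rung-uv-unused)
        ¬ss′₁ : ¬ F (s (sq 1)) (s′ (sq 1))
        ¬ss′₁ = proj₂ (outer-unused (sq 1) ¬pp′₁ rung-uv-unused)
        ¬qq′₀ : ¬ F (q (sq 0)) (q′ (sq 0))
        ¬qq′₀ = ¬pp′₁ ∘ rung q′≡p p′≡q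
        ¬ss′₀ : ¬ F (s (sq 0)) (s′ (sq 0))
        ¬ss′₀ = rung-uv-unused ∘ rung s′≡r r′≡s
        ¬rr′₀ : ¬ F (r (sq 0)) (r′ (sq 0))
        ¬rr′₀ = proj₁ (outer-unused (rotate (sq 0)) ¬qq′₀ ¬ss′₀)
        ¬pp′₀ : ¬ F (p (sq 0)) (p′ (sq 0))
        ¬pp′₀ = proj₂ (outer-unused (rotate (sq 0)) ¬qq′₀ ¬ss′₀)

    absurd : u ≡ s last ⊎ u ≡ q last → ∀ w → ¬ (w ∈□ sq 0 ⊎ w ∈□ sq 1) → ⊥
    absurd closes w w∉ with one-unused (p-nbrs (sq 1))
    ... | unused-a _ _ pp′ = around pp′ closes
    ... | unused-b _ _ pp′ = around pp′ closes
    ... | unused-c _ _ ¬pp′ = w∉ (squares-isolated ¬pp′ w)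

  -- If a 2-factor separates the ends u = s₀ and v = r₁ of a rung, either p₁ avoids its outer edge, and
  -- then squares 0 and 1 are whole components, or the cycle through v is pushed along the ladder until
  -- it closes up at u.
  ladder-not-separating : (sq : ℕ → Square A) (K : ℕ) → (∀ k → k ≤ K → Rungs (sq k) (sq (suc k))) →
    (last : Square A) → Rungs (sq (suc K)) last →
    Square.s (sq 0) ≡ Square.s last ⊎ Square.s (sq 0) ≡ Square.q last →
    ∀ w → ¬ (w ∈□ sq 0 ⊎ w ∈□ sq 1) → ¬ Separating2Factor A (Square.s (sq 0)) (Square.r (sq 1))
  ladder-not-separating sq K rungs last closing closes w w∉ (F , F-2factor , u≁v , cover) =
    LadderArgument.absurd sq K rungs last closing F F-2factor u≁v cover closes w w∉

-- The honeycomb toroidal graph HTG(m, n, 2)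

ShiftMod-unique : ∀ n a k {b b′} → b < n → b′ < n → ShiftMod n a k b → ShiftMod n a k b′ → b ≡ b′
ShiftMod-unique (suc n) a k {b} {b′} b<n b′<n (q , a+k≡) (q′ , a+k≡′) = begin
  b                   ≡⟨ m<n⇒m%n≡m b<n ⟨
  b % suc n           ≡⟨ [m+kn]%n≡m%n b q (suc n) ⟨
  (b + q * suc n) % suc n   ≡⟨ cong (_% suc n) (trans (sym a+k≡) a+k≡′) ⟩
  (b′ + q′ * suc n) % suc n ≡⟨ [m+kn]%n≡m%n b′ q′ (suc n) ⟩
  b′ % suc n          ≡⟨ m<n⇒m%n≡m b′<n ⟩
  b′                  ∎
  where open ≡-Reasoning

ShiftMod-+ : ∀ n {a b c} k l → ShiftMod n a k b → ShiftMod n b l c → ShiftMod n a (k + l) c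
ShiftMod-+ n {a} {b} {c} k l (q , a+k≡) (q′ , b+l≡) = q′ + q , (begin
  a + (k + l)          ≡⟨ +-assoc a k l ⟨
  a + k + l            ≡⟨ cong (_+ l) a+k≡ ⟩
  b + q * n + l        ≡⟨ +-assoc b (q * n) l ⟩
  b + (q * n + l)      ≡⟨ cong (b +_) (+-comm (q * n) l) ⟩
  b + (l + q * n)      ≡⟨ +-assoc b l (q * n) ⟨
  b + l + q * n        ≡⟨ cong (_+ q * n) b+l≡ ⟩
  c + q′ * n + q * n   ≡⟨ +-assoc c (q′ * n) (q * n) ⟩
  c + (q′ * n + q * n) ≡⟨ cong (c +_) (*-distribʳ-+ n q′ q) ⟨
  c + (q′ + q) * n     ∎)
  where open ≡-Reasoning

ShiftMod-% : ∀ n .{{_ : NonZero n}} a k → ShiftMod n a k ((a + k) % n)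
ShiftMod-% n a k = (a + k) / n , m≡m%n+[m/n]*n (a + k) n

[m%n+k]%n≡[m+k]%n : ∀ m k n .{{_ : NonZero n}} → (m % n + k) % n ≡ (m + k) % n
[m%n+k]%n≡[m+k]%n m k n = begin
  (m % n + k) % n          ≡⟨ %-distribˡ-+ (m % n) k n ⟩
  (m % n % n + k % n) % n  ≡⟨ cong (λ a → (a + k % n) % n) (m%n%n≡m%n m n) ⟩
  (m % n + k % n) % n      ≡⟨ %-distribˡ-+ m k n ⟨
  (m + k) % n              ∎
  where open ≡-Reasoning

odd-% : ∀ j n .{{_ : NonZero n}} → odd n ≡ false → odd (j % n) ≡ odd j
odd-% j n n-even = sym (begin
  odd j                             ≡⟨ cong odd (m≡m%n+[m/n]*n j n) ⟩
  odd (j % n + j / n * n)           ≡⟨ odd-+ (j % n) (j / n * n) ⟩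
  odd (j % n) xor odd (j / n * n)   ≡⟨ cong (odd (j % n) xor_) (odd-*-even (j / n) n-even) ⟩
  odd (j % n) xor false             ≡⟨ xor-comm (odd (j % n)) false ⟩
  odd (j % n)                       ∎)
  where open ≡-Reasoning

ShiftMod-self : ∀ n {a} k → ShiftMod n a k a → 0 < k → k < n → ⊥
ShiftMod-self n {a} k (q , a+k≡) 0<k k<n with +-cancelˡ-≡ a k (q * n) a+k≡
ShiftMod-self n {a} k (zero , _) 0<k k<n | k≡0 = <-irrefl (sym k≡0) 0<k
ShiftMod-self n {a} k (suc q , _) 0<k k<n | k≡ = <⇒≱ k<n (subst (n ≤_) (sym k≡) (m≤m+n n (q * n)))

odd⇒%2≡1 : ∀ k → odd k ≡ true → k % 2 ≡ 1
odd⇒%2≡1 zero ()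
odd⇒%2≡1 (suc zero) _ = refl
odd⇒%2≡1 (suc (suc k)) e = odd⇒%2≡1 k (trans (sym (odd-suc-suc k)) e)

even⇒%2≡0 : ∀ k → odd k ≡ false → k % 2 ≡ 0
even⇒%2≡0 zero _ = refl
even⇒%2≡0 (suc zero) ()
even⇒%2≡0 (suc (suc k)) e = even⇒%2≡0 k (trans (sym (odd-suc-suc k)) e)

%2≡1⇒odd : ∀ k → k % 2 ≡ 1 → odd k ≡ true
%2≡1⇒odd zero ()
%2≡1⇒odd (suc zero) _ = refl
%2≡1⇒odd (suc (suc k)) e = trans (odd-suc-suc k) (%2≡1⇒odd k e)

%2≡0⇒even : ∀ k → k % 2 ≡ 0 → odd k ≡ false
%2≡0⇒even zero _ = refl
%2≡0⇒even (suc zero) ()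
%2≡0⇒even (suc (suc k)) e = trans (odd-suc-suc k) (%2≡0⇒even k e)

module Honeycomb (m₀ n₀ : ℕ) (m₀-odd : odd m₀ ≡ true) (n₀-odd : odd n₀ ≡ true) (2≤n₀ : 2 ≤ n₀) where

  m n : ℕ
  m = suc m₀
  n = suc n₀

  V : Set
  V = Vertex m n

  col row : V → ℕ
  col = toℕ ∘ proj₁
  row = toℕ ∘ proj₂

  vertex-≡ : ∀ {x y : V} → col x ≡ col y → row x ≡ row y → x ≡ y
  vertex-≡ e₁ e₂ = cong₂ _,_ (Fin.toℕ-injective e₁) (Fin.toℕ-injective e₂)

  rowUp rowDown : Fin n → Fin n
  rowUp j with suc (toℕ j) <? n
  ... | yes j+1<n = fromℕ< j+1<n
  ... | no _ = fz
  rowDown fz = fromℕ n₀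
  rowDown (fs j) = inject₁ j

  private
    top-of : ∀ {k} (j : Fin (suc k)) → ¬ suc (toℕ j) < suc k → toℕ j ≡ k
    top-of j ¬j+1<n = suc-injective (≤-antisym (Fin.toℕ<n j) (≮⇒≥ ¬j+1<n))

  toℕ-rowUp : ∀ j → suc (toℕ j) < n → toℕ (rowUp j) ≡ suc (toℕ j)
  toℕ-rowUp j j+1<n with suc (toℕ j) <? n
  ... | yes p = Fin.toℕ-fromℕ< p
  ... | no ¬p = contradiction j+1<n ¬p

  toℕ-rowUp-top : ∀ j → toℕ j ≡ n₀ → toℕ (rowUp j) ≡ 0
  toℕ-rowUp-top j j≡n₀ with suc (toℕ j) <? n
  ... | yes p = contradiction (subst (λ k → suc k < n) j≡n₀ p) (<-irrefl refl)
  ... | no _ = refl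

  toℕ-rowDown : ∀ j k → toℕ j ≡ suc k → toℕ (rowDown j) ≡ k
  toℕ-rowDown (fs j) k e = trans (Fin.toℕ-inject₁ j) (suc-injective e)

  toℕ-rowDown-0 : ∀ j → toℕ j ≡ 0 → toℕ (rowDown j) ≡ n₀
  toℕ-rowDown-0 fz _ = Fin.toℕ-fromℕ n₀

  rowUp-rowDown : ∀ j → rowUp (rowDown j) ≡ j
  rowUp-rowDown fz = Fin.toℕ-injective (toℕ-rowUp-top (fromℕ n₀) (Fin.toℕ-fromℕ n₀))
  rowUp-rowDown (fs j) = Fin.toℕ-injective (trans (toℕ-rowUp (inject₁ j) bound) (cong suc (Fin.toℕ-inject₁ j)))
    where
      bound : suc (toℕ (inject₁ j)) < n
      bound = subst (λ k → suc k < n) (sym (Fin.toℕ-inject₁ j)) (s≤s (Fin.toℕ<n j))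

  rowDown-rowUp : ∀ j → rowDown (rowUp j) ≡ j
  rowDown-rowUp j with suc (toℕ j) <? n
  ... | yes p = Fin.toℕ-injective (toℕ-rowDown (fromℕ< p) (toℕ j) (Fin.toℕ-fromℕ< p))
  ... | no ¬p = Fin.toℕ-injective (trans (Fin.toℕ-fromℕ n₀) (sym (top-of j ¬p)))

  odd-rowUp : ∀ j → odd (toℕ (rowUp j)) ≡ not (odd (toℕ j))
  odd-rowUp j with suc (toℕ j) <? n
  ... | yes p = cong odd (Fin.toℕ-fromℕ< p)
  ... | no ¬p = sym (trans (cong (not ∘ odd) (top-of j ¬p)) (cong not n₀-odd))

  ShiftMod-rowUp : ∀ j → ShiftMod n (toℕ j) 1 (toℕ (rowUp j))
  ShiftMod-rowUp j with suc (toℕ j) <? n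
  ... | yes p = 0 , trans (+-comm (toℕ j) 1) (sym (trans (+-identityʳ _) (Fin.toℕ-fromℕ< p)))
  ... | no ¬p = 1 , trans (+-comm (toℕ j) 1) (trans (cong suc (top-of j ¬p)) (sym (+-identityʳ n)))

  ShiftMod-rowUp² : ∀ j → ShiftMod n (toℕ j) 2 (toℕ (rowUp (rowUp j)))
  ShiftMod-rowUp² j = ShiftMod-+ n 1 1 (ShiftMod-rowUp j) (ShiftMod-rowUp (rowUp j))

  rowUp≢ : ∀ j → rowUp j ≢ j
  rowUp≢ j e = ShiftMod-self n 1 (subst (ShiftMod n (toℕ j) 1 ∘ toℕ) e (ShiftMod-rowUp j)) (s≤s z≤n) (s≤s (≤-trans (n≤1+n 1) 2≤n₀))

  rowUp²≢ : ∀ j → rowUp (rowUp j) ≢ j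
  rowUp²≢ j e = ShiftMod-self n 2 (subst (ShiftMod n (toℕ j) 2 ∘ toℕ) e (ShiftMod-rowUp² j)) (s≤s z≤n) (s≤s 2≤n₀)

  m₀≢0 : m₀ ≢ 0
  m₀≢0 m₀≡0 with trans (sym (cong odd m₀≡0)) m₀-odd
  ... | ()

  up down : V → V
  up (i , j) = i , rowUp j
  down (i , j) = i , rowDown j

  up-down : ∀ x → up (down x) ≡ x
  up-down (i , j) = cong (i ,_) (rowUp-rowDown j)

  down-up : ∀ x → down (up x) ≡ x
  down-up (i , j) = cong (i ,_) (rowDown-rowUp j)

  up² : V → V
  up² = up ∘ up

  up≢ : ∀ x → up x ≢ x
  up≢ (i , j) e = rowUp≢ j (cong proj₂ e)

  up≢down : ∀ x → up x ≢ down x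
  up≢down (i , j) e = rowUp²≢ j (cong proj₂ (trans (cong up e) (up-down (i , j))))

  colour : V → Bool
  colour x = odd (col x + row x)

  odd-col+rowUp : ∀ i j → odd (i + toℕ (rowUp j)) ≡ not (odd (i + toℕ j))
  odd-col+rowUp i j = begin
    odd (i + toℕ (rowUp j))        ≡⟨ odd-+ i _ ⟩
    odd i xor odd (toℕ (rowUp j))  ≡⟨ cong (odd i xor_) (odd-rowUp j) ⟩
    odd i xor not (odd (toℕ j))    ≡⟨ not-distribʳ-xor (odd i) _ ⟨
    not (odd i xor odd (toℕ j))    ≡⟨ cong not (odd-+ i (toℕ j)) ⟨
    not (odd (i + toℕ j))          ∎
    where open ≡-Reasoning

  colour-up : ∀ x → colour (up x) ≡ not (colour x)
  colour-up (i , j) = odd-col+rowUp (toℕ i) j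

  colour-down : ∀ x → colour (down x) ≡ not (colour x)
  colour-down x = begin
    colour (down x)             ≡⟨ not-involutive _ ⟨
    not (not (colour (down x))) ≡⟨ cong not (colour-up (down x)) ⟨
    not (colour (up (down x)))  ≡⟨ cong (not ∘ colour) (up-down x) ⟩
    not (colour x)              ∎
    where open ≡-Reasoning

  colour-up² : ∀ x → colour (up² x) ≡ colour x
  colour-up² x = trans (colour-up (up x)) (trans (cong not (colour-up x)) (not-involutive _))

  -- Moving along the flat or jump edge at x: rightwards when colour x ≡ true, leftwards otherwise.
  horizontal : Bool → V → V
  horizontal true (i , j) with suc (toℕ i) <? m
  ... | yes i+1<m = fromℕ< i+1<m , j
  ... | no _ = fz , rowUp (rowUp j)
  horizontal false (fz , j) = fromℕ m₀ , rowDown (rowDown j)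
  horizontal false (fs i , j) = inject₁ i , j

  hor : V → V
  hor x = horizontal (colour x) x

  odd-rowUp² : ∀ j → odd (toℕ (rowUp (rowUp j))) ≡ odd (toℕ j)
  odd-rowUp² j = trans (odd-rowUp (rowUp j)) (trans (cong not (odd-rowUp j)) (not-involutive _))

  private
    odd-rowDown : ∀ j → odd (toℕ (rowDown j)) ≡ not (odd (toℕ j))
    odd-rowDown j = begin
      odd (toℕ (rowDown j))                  ≡⟨ not-involutive _ ⟨
      not (not (odd (toℕ (rowDown j))))      ≡⟨ cong not (odd-rowUp (rowDown j)) ⟨
      not (odd (toℕ (rowUp (rowDown j))))    ≡⟨ cong (not ∘ odd ∘ toℕ) (rowUp-rowDown j) ⟩
      not (odd (toℕ j))                      ∎
      where open ≡-Reasoning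

    odd-rowDown² : ∀ j → odd (toℕ (rowDown (rowDown j))) ≡ odd (toℕ j)
    odd-rowDown² j = trans (odd-rowDown (rowDown j)) (trans (cong not (odd-rowDown j)) (not-involutive _))

    odd-m₀+ : ∀ k → odd (m₀ + k) ≡ not (odd k)
    odd-m₀+ k = trans (odd-+ m₀ k) (cong (_xor odd k) m₀-odd)

  colour-horizontal : ∀ b x → colour x ≡ b → colour (horizontal b x) ≡ not b
  colour-horizontal true (i , j) c with suc (toℕ i) <? m
  ... | yes i+1<m = trans (cong (odd ∘ (_+ toℕ j)) (Fin.toℕ-fromℕ< i+1<m)) (cong not c)
  ... | no i+1≮m = begin
    odd (toℕ (rowUp (rowUp j)))  ≡⟨ odd-rowUp² j ⟩
    odd (toℕ j)                  ≡⟨ not-involutive _ ⟨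
    not (not (odd (toℕ j)))      ≡⟨ cong not (odd-m₀+ (toℕ j)) ⟨
    not (odd (m₀ + toℕ j))       ≡⟨ cong (λ k → not (odd (k + toℕ j))) (top-of i i+1≮m) ⟨
    not (colour (i , j))         ≡⟨ cong not c ⟩
    false                        ∎
    where open ≡-Reasoning
  colour-horizontal false (fz , j) c = begin
    odd (toℕ (fromℕ m₀) + toℕ (rowDown (rowDown j)))  ≡⟨ cong (odd ∘ (_+ toℕ (rowDown (rowDown j)))) (Fin.toℕ-fromℕ m₀) ⟩
    odd (m₀ + toℕ (rowDown (rowDown j)))              ≡⟨ odd-m₀+ _ ⟩
    not (odd (toℕ (rowDown (rowDown j))))             ≡⟨ cong not (trans (odd-rowDown² j) c) ⟩
    true                                              ∎
    where open ≡-Reasoning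
  colour-horizontal false (fs i , j) c =
    trans (cong (odd ∘ (_+ toℕ j)) (Fin.toℕ-inject₁ i)) (trans (sym (not-involutive _)) (cong not c))

  colour-hor : ∀ x → colour (hor x) ≡ not (colour x)
  colour-hor x = colour-horizontal (colour x) x refl

  horizontal-involutive : ∀ b x → colour x ≡ b → horizontal (not b) (horizontal b x) ≡ x
  horizontal-involutive true (i , j) _ with suc (toℕ i) <? m
  ... | yes i+1<m =
        vertex-≡ (trans (Fin.toℕ-inject₁ (fromℕ< (s≤s⁻¹ i+1<m))) (Fin.toℕ-fromℕ< (s≤s⁻¹ i+1<m))) refl
  ... | no i+1≮m =
        vertex-≡ (trans (Fin.toℕ-fromℕ m₀) (sym (top-of i i+1≮m)))
                 (cong toℕ (trans (cong rowDown (rowDown-rowUp (rowUp j))) (rowDown-rowUp j)))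
  horizontal-involutive false (fz , j) _ with suc (toℕ (fromℕ m₀)) <? m
  ... | yes m<m = contradiction (subst (_< m) (cong suc (Fin.toℕ-fromℕ m₀)) m<m) (<-irrefl refl)
  ... | no _ = cong (fz ,_) (trans (cong rowUp (rowUp-rowDown (rowDown j))) (rowUp-rowDown j))
  horizontal-involutive false (fs i , j) _ with suc (toℕ (inject₁ i)) <? m
  ... | yes i+1<m = vertex-≡ (trans (Fin.toℕ-fromℕ< i+1<m) (cong suc (Fin.toℕ-inject₁ i))) refl
  ... | no i+1≮m = contradiction (subst (λ k → suc k < m) (sym (Fin.toℕ-inject₁ i)) (s≤s (Fin.toℕ<n i))) i+1≮m

  hor-involutive : ∀ x → hor (hor x) ≡ x
  hor-involutive x = trans (cong (λ c → horizontal c (hor x)) (colour-hor x)) (horizontal-involutive (colour x) x refl)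

  horizontal-up² : ∀ b i j → horizontal b (i , rowUp (rowUp j)) ≡ up² (horizontal b (i , j))
  horizontal-up² true i j with suc (toℕ i) <? m
  ... | yes _ = refl
  ... | no _ = refl
  horizontal-up² false fz j = cong (fromℕ m₀ ,_) (begin
    rowDown (rowDown (rowUp (rowUp j)))  ≡⟨ cong rowDown (rowDown-rowUp (rowUp j)) ⟩
    rowDown (rowUp j)                    ≡⟨ rowDown-rowUp j ⟩
    j                                    ≡⟨ rowUp-rowDown j ⟨
    rowUp (rowDown j)                    ≡⟨ cong rowUp (rowUp-rowDown (rowDown j)) ⟨
    rowUp (rowUp (rowDown (rowDown j)))  ∎)
    where open ≡-Reasoning
  horizontal-up² false (fs i) j = refl

  hor-up² : ∀ x → hor (up² x) ≡ up² (hor x)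
  hor-up² (i , j) = trans (cong (λ c → horizontal c (i , rowUp (rowUp j))) (colour-up² (i , j)))
                          (horizontal-up² (colour (i , j)) i j)

  col-horizontal≢ : ∀ b x → col (horizontal b x) ≢ col x
  col-horizontal≢ true (i , j) with suc (toℕ i) <? m
  ... | yes i+1<m = 1+n≢n ∘ trans (sym (Fin.toℕ-fromℕ< i+1<m))
  ... | no i+1≮m = m₀≢0 ∘ sym ∘ flip trans (top-of i i+1≮m)
  col-horizontal≢ false (fz , j) = m₀≢0 ∘ trans (sym (Fin.toℕ-fromℕ m₀))
  col-horizontal≢ false (fs i , j) e = 1+n≢n (sym (trans (sym (Fin.toℕ-inject₁ i)) e))

  hor≢ : ∀ x → hor x ≢ x
  hor≢ x = col-horizontal≢ (colour x) x ∘ cong col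

  up≢hor : ∀ x → up x ≢ hor x
  up≢hor x = col-horizontal≢ (colour x) x ∘ sym ∘ cong col

  down≢hor : ∀ x → down x ≢ hor x
  down≢hor x = col-horizontal≢ (colour x) x ∘ sym ∘ cong col

  hor-by-colour : ∀ x b → colour x ≡ b → hor x ≡ horizontal b x
  hor-by-colour x b c = cong (λ b → horizontal b x) c

  horizontal-inner : ∀ i j (i+1<m : suc (toℕ i) < m) → horizontal true (i , j) ≡ (fromℕ< i+1<m , j)
  horizontal-inner i j i+1<m with suc (toℕ i) <? m
  ... | yes _ = refl
  ... | no i+1≮m = contradiction i+1<m i+1≮m

  horizontal-last : ∀ i j → toℕ i ≡ m₀ → horizontal true (i , j) ≡ (fz , rowUp (rowUp j))
  horizontal-last i j i≡m₀ with suc (toℕ i) <? m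
  ... | yes i+1<m = contradiction (subst (λ k → suc k < m) i≡m₀ i+1<m) (<-irrefl refl)
  ... | no _ = refl

  private
    m%2≡0 : m % 2 ≡ 0
    m%2≡0 = even⇒%2≡0 m (cong not m₀-odd)

  gen⇒up⊎hor : ∀ {x y} → Gen m n 2 x y → y ≡ up x ⊎ y ≡ hor x
  gen⇒up⊎hor (vertical i j j′ shift) =
    inj₁ (cong (i ,_) (Fin.toℕ-injective
      (ShiftMod-unique n (toℕ j) 1 (Fin.toℕ<n j′) (Fin.toℕ<n (rowUp j)) shift (ShiftMod-rowUp j))))
  gen⇒up⊎hor (flat i i′ j i′≡i+1 i+j-odd) = inj₂ (begin
    (i′ , j)                   ≡⟨ vertex-≡ (trans i′≡i+1 (sym (Fin.toℕ-fromℕ< i+1<m))) refl ⟩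
    (fromℕ< i+1<m , j)         ≡⟨ horizontal-inner i j i+1<m ⟨
    horizontal true (i , j)    ≡⟨ hor-by-colour (i , j) true (%2≡1⇒odd (toℕ i + toℕ j) i+j-odd) ⟨
    hor (i , j)                ∎)
    where
      open ≡-Reasoning
      i+1<m : suc (toℕ i) < m
      i+1<m = subst (_< m) i′≡i+1 (Fin.toℕ<n i′)
  gen⇒up⊎hor (jump i i′ j j′ i+1≡m i′≡0 j-parity shift) = inj₂ (begin
    (i′ , j′)                  ≡⟨ vertex-≡ i′≡0 (ShiftMod-unique n (toℕ j) 2 (Fin.toℕ<n j′) (Fin.toℕ<n (rowUp (rowUp j))) shift (ShiftMod-rowUp² j)) ⟩
    (fz , rowUp (rowUp j))     ≡⟨ horizontal-last i j (suc-injective i+1≡m) ⟨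
    horizontal true (i , j)    ≡⟨ hor-by-colour (i , j) true colour-true ⟨
    hor (i , j)                ∎)
    where
      open ≡-Reasoning
      colour-true : colour (i , j) ≡ true
      colour-true = begin
        odd (toℕ i + toℕ j)   ≡⟨ cong (λ k → odd (k + toℕ j)) (suc-injective i+1≡m) ⟩
        odd (m₀ + toℕ j)      ≡⟨ odd-m₀+ (toℕ j) ⟩
        not (odd (toℕ j))     ≡⟨ cong not (%2≡0⇒even (toℕ j) (trans j-parity m%2≡0)) ⟩
        true                  ∎

  gen-up : ∀ x → Gen m n 2 x (up x)
  gen-up (i , j) = vertical i j (rowUp j) (ShiftMod-rowUp j)

  gen-hor : ∀ x → colour x ≡ true → Gen m n 2 x (hor x)
  gen-hor (i , j) c = subst (Gen m n 2 (i , j)) (sym (hor-by-colour (i , j) true c)) (gen-horizontal (suc (toℕ i) <? m))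
    where
      gen-horizontal : Dec (suc (toℕ i) < m) → Gen m n 2 (i , j) (horizontal true (i , j))
      gen-horizontal (yes i+1<m) = subst (Gen m n 2 (i , j)) (sym (horizontal-inner i j i+1<m))
        (flat i (fromℕ< i+1<m) j (Fin.toℕ-fromℕ< i+1<m) (odd⇒%2≡1 (toℕ i + toℕ j) c))
      gen-horizontal (no i+1≮m) = subst (Gen m n 2 (i , j)) (sym (horizontal-last i j (top-of i i+1≮m)))
        (jump i fz j (rowUp (rowUp j)) (cong suc (top-of i i+1≮m)) refl
              (trans (even⇒%2≡0 (toℕ j) j-even) (sym m%2≡0)) (ShiftMod-rowUp² j))
        where
          j-even : odd (toℕ j) ≡ false
          j-even = begin
            odd (toℕ j)               ≡⟨ not-involutive _ ⟨
            not (not (odd (toℕ j)))   ≡⟨ cong not (odd-m₀+ (toℕ j)) ⟨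
            not (odd (m₀ + toℕ j))    ≡⟨ cong (λ k → not (odd (k + toℕ j))) (top-of i i+1≮m) ⟨
            not (colour (i , j))      ≡⟨ cong not c ⟩
            false                     ∎
            where open ≡-Reasoning

  Adjacent : V → V → Set
  Adjacent = Adj m n 2

  adj-sym : ∀ {x y} → Adjacent x y → Adjacent y x
  adj-sym (x≢y , g) = x≢y ∘ sym , Sum.swap g

  adj-up : ∀ x → Adjacent x (up x)
  adj-up x = up≢ x ∘ sym , inj₁ (gen-up x)

  adj-down : ∀ x → Adjacent x (down x)
  adj-down x = adj-sym (subst (λ y → Adjacent (down x) y) (up-down x) (adj-up (down x)))

  adj-hor : ∀ x → Adjacent x (hor x)
  adj-hor x = hor≢ x ∘ sym , gen-either (colour x) refl
    where
      gen-either : ∀ b → colour x ≡ b → Gen m n 2 x (hor x) ⊎ Gen m n 2 (hor x) x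
      gen-either true c = inj₁ (gen-hor x c)
      gen-either false c = inj₂ (subst (Gen m n 2 (hor x)) (hor-involutive x)
                                       (gen-hor (hor x) (trans (colour-hor x) (cong not c))))

  adj⇒up⊎down⊎hor : ∀ {x y} → Adjacent x y → y ≡ up x ⊎ y ≡ down x ⊎ y ≡ hor x
  adj⇒up⊎down⊎hor {x} {y} (_ , inj₁ g) = Sum.map₂ inj₂ (gen⇒up⊎hor g)
  adj⇒up⊎down⊎hor {x} {y} (_ , inj₂ g) with gen⇒up⊎hor g
  ... | inj₁ x≡up-y = inj₂ (inj₁ (trans (sym (down-up y)) (cong down (sym x≡up-y))))
  ... | inj₂ x≡hor-y = inj₂ (inj₂ (trans (sym (hor-involutive y)) (cong hor (sym x≡hor-y))))

  nbr : V → Dir → V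
  nbr x ↑ = up x
  nbr x ↓ = down x
  nbr x ⇄ = hor x

  nbr-opp : ∀ x d → nbr (nbr x d) (opp d) ≡ x
  nbr-opp x ↑ = down-up x
  nbr-opp x ↓ = up-down x
  nbr-opp x ⇄ = hor-involutive x

  nbr-adj : ∀ x d → Adjacent x (nbr x d)
  nbr-adj x ↑ = adj-up x
  nbr-adj x ↓ = adj-down x
  nbr-adj x ⇄ = adj-hor x

  adj⇒nbr : ∀ {x y} → Adjacent x y → ∃ λ d → y ≡ nbr x d
  adj⇒nbr xy with adj⇒up⊎down⊎hor xy
  ... | inj₁ e = ↑ , e
  ... | inj₂ (inj₁ e) = ↓ , e
  ... | inj₂ (inj₂ e) = ⇄ , e

  nbr-injective : ∀ x {d e} → nbr x d ≡ nbr x e → d ≡ e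
  nbr-injective x {↑} {↑} _ = refl
  nbr-injective x {↑} {↓} e = contradiction e (up≢down x)
  nbr-injective x {↑} {⇄} e = contradiction e (up≢hor x)
  nbr-injective x {↓} {↑} e = contradiction (sym e) (up≢down x)
  nbr-injective x {↓} {↓} _ = refl
  nbr-injective x {↓} {⇄} e = contradiction e (down≢hor x)
  nbr-injective x {⇄} {↑} e = contradiction (sym e) (up≢hor x)
  nbr-injective x {⇄} {↓} e = contradiction (sym e) (down≢hor x)
  nbr-injective x {⇄} {⇄} _ = refl

  open CubicGraph Adjacent nbr nbr-adj adj⇒nbr nbr-injective adj-sym public

  nbr-neighbours : ∀ x {a b c} da db dc → nbr x da ≡ a → nbr x db ≡ b → nbr x dc ≡ c →
                   da ≢ db → da ≢ dc → db ≢ dc → Neighbours Adjacent x a b c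
  nbr-neighbours x da db dc refl refl refl da≢db da≢dc db≢dc = record
    { only = only
    ; a≢b = da≢db ∘ nbr-injective x ; a≢c = da≢dc ∘ nbr-injective x ; b≢c = db≢dc ∘ nbr-injective x }
    where
      only : ∀ {y} → Adjacent x y → y ≡ nbr x da ⊎ y ≡ nbr x db ⊎ y ≡ nbr x dc
      only xy with adj⇒nbr xy
      ... | d , refl = Sum.map (cong (nbr x)) (Sum.map (cong (nbr x)) (cong (nbr x)))
                               (distinct-dirs-cover da≢db da≢dc db≢dc d)

  pt : ℕ → ℕ → V
  pt i j = i mod m , j mod n

  col-pt : ∀ {i} j → i < m → col (pt i j) ≡ i
  col-pt {i} j i<m = trans (Fin.toℕ-fromℕ< (m%n<n i m)) (m<n⇒m%n≡m i<m)

  row-pt : ∀ i {j} → j < n → row (pt i j) ≡ j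
  row-pt i {j} j<n = trans (Fin.toℕ-fromℕ< (m%n<n j n)) (m<n⇒m%n≡m j<n)

  pt-col-row : ∀ x → pt (col x) (row x) ≡ x
  pt-col-row x = vertex-≡ (col-pt (row x) (Fin.toℕ<n (proj₁ x))) (row-pt (col x) (Fin.toℕ<n (proj₂ x)))

  up-pt : ∀ i j → up (pt i j) ≡ pt i (suc j)
  up-pt i j = cong (i mod m ,_) (Fin.toℕ-injective (begin
    toℕ (rowUp (j mod n))  ≡⟨ ShiftMod-unique n (toℕ (j mod n)) 1 (Fin.toℕ<n (rowUp (j mod n))) (m%n<n (toℕ (j mod n) + 1) n)
                                (ShiftMod-rowUp (j mod n)) (ShiftMod-% n (toℕ (j mod n)) 1) ⟩
    (toℕ (j mod n) + 1) % n ≡⟨ cong (λ a → (a + 1) % n) (Fin.toℕ-fromℕ< (m%n<n j n)) ⟩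
    (j % n + 1) % n         ≡⟨ [m%n+k]%n≡[m+k]%n j 1 n ⟩
    (j + 1) % n             ≡⟨ cong (_% n) (+-comm j 1) ⟩
    suc j % n               ≡⟨ Fin.toℕ-fromℕ< (m%n<n (suc j) n) ⟨
    toℕ (suc j mod n)       ∎))
    where open ≡-Reasoning

  down-pt : ∀ i j → down (pt i (suc j)) ≡ pt i j
  down-pt i j = trans (cong down (sym (up-pt i j))) (down-up (pt i j))

  colour-pt : ∀ {i} j → i < m → colour (pt i j) ≡ odd (i + j)
  colour-pt {i} j i<m = begin
    odd (col (pt i j) + toℕ (j mod n))  ≡⟨ cong (λ k → odd (k + toℕ (j mod n))) (col-pt j i<m) ⟩
    odd (i + toℕ (j mod n))            ≡⟨ cong (λ k → odd (i + k)) (Fin.toℕ-fromℕ< (m%n<n j n)) ⟩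
    odd (i + j % n)                    ≡⟨ odd-+ i (j % n) ⟩
    odd i xor odd (j % n)              ≡⟨ cong (odd i xor_) (odd-% j n (cong not n₀-odd)) ⟩
    odd i xor odd j                    ≡⟨ odd-+ i j ⟨
    odd (i + j)                        ∎
    where open ≡-Reasoning

  pt-periodic : ∀ i j → pt i (n + j) ≡ pt i j
  pt-periodic i j = cong (i mod m ,_) (Fin.toℕ-injective (begin
    toℕ ((n + j) mod n)  ≡⟨ Fin.toℕ-fromℕ< (m%n<n (n + j) n) ⟩
    (n + j) % n          ≡⟨ cong (_% n) (+-comm n j) ⟩
    (j + n) % n          ≡⟨ [m+n]%n≡m%n j n ⟩
    j % n                ≡⟨ Fin.toℕ-fromℕ< (m%n<n j n) ⟨
    toℕ (j mod n)        ∎))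
    where open ≡-Reasoning

  hor-pt-right : ∀ {i} j → suc i < m → odd (i + j) ≡ true → hor (pt i j) ≡ pt (suc i) j
  hor-pt-right {i} j i+1<m i+j-odd = begin
    hor (pt i j)                ≡⟨ hor-by-colour (pt i j) true (trans (colour-pt j (≤-trans (n≤1+n _) i+1<m)) i+j-odd) ⟩
    horizontal true (pt i j)    ≡⟨ horizontal-inner (i mod m) (j mod n) i+1<m′ ⟩
    fromℕ< i+1<m′ , j mod n     ≡⟨ vertex-≡ (trans (Fin.toℕ-fromℕ< i+1<m′) (trans (cong suc (col-pt j (≤-trans (n≤1+n _) i+1<m))) (sym (col-pt j i+1<m)))) refl ⟩
    pt (suc i) j                ∎
    where
      open ≡-Reasoning
      i+1<m′ : suc (col (pt i j)) < m
      i+1<m′ = subst (λ k → suc k < m) (sym (col-pt j (≤-trans (n≤1+n _) i+1<m))) i+1<m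

  hor-pt-jump : ∀ j → odd j ≡ false → hor (pt m₀ j) ≡ pt 0 (2 + j)
  hor-pt-jump j j-even = begin
    hor (pt m₀ j)              ≡⟨ hor-by-colour (pt m₀ j) true (trans (colour-pt j ≤-refl) (trans (odd-m₀+ j) (cong not j-even))) ⟩
    horizontal true (pt m₀ j)  ≡⟨ horizontal-last (m₀ mod m) (j mod n) (col-pt j ≤-refl) ⟩
    up (up (pt 0 j))           ≡⟨ cong up (up-pt 0 j) ⟩
    up (pt 0 (1 + j))          ≡⟨ up-pt 0 (1 + j) ⟩
    pt 0 (2 + j)               ∎
    where open ≡-Reasoning

  hor-pt-left : ∀ {i} j → suc i < m → odd (suc i + j) ≡ false → hor (pt (suc i) j) ≡ pt i j
  hor-pt-left {i} j i+1<m i+1+j-even = begin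
    hor (pt (suc i) j)  ≡⟨ cong hor (hor-pt-right j i+1<m i+j-odd) ⟨
    hor (hor (pt i j))  ≡⟨ hor-involutive (pt i j) ⟩
    pt i j              ∎
    where
      open ≡-Reasoning
      i+j-odd : odd (i + j) ≡ true
      i+j-odd = trans (sym (not-involutive _)) (cong not i+1+j-even)

  hor-pt-jump-back : ∀ j → odd j ≡ false → hor (pt 0 (2 + j)) ≡ pt m₀ j
  hor-pt-jump-back j j-even = begin
    hor (pt 0 (2 + j))   ≡⟨ cong hor (hor-pt-jump j j-even) ⟨
    hor (hor (pt m₀ j))  ≡⟨ hor-involutive (pt m₀ j) ⟩
    pt m₀ j              ∎
    where open ≡-Reasoning

  consistent⇒perfect : ∀ {μ} → (∀ x → μ (nbr x (μ x)) ≡ opp (μ x)) → IsPerfectMatching μ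
  consistent⇒perfect {μ} consistent = perfect-matching λ x → trans (cong (nbr (partner μ x)) (consistent x)) (nbr-opp x (μ x))

  pt-wrap : ∀ i → pt i n ≡ pt i 0
  pt-wrap i = cong (i mod m ,_) (Fin.toℕ-injective (trans (Fin.toℕ-fromℕ< (m%n<n n n)) (n%n≡0 n)))

  module Steps (μ : V → Dir) where
    step : ∀ x d → d ≢ μ x → Star (Unmatched μ) x (nbr x d)
    step x d d≢μx = unmatched-step {μ} x d d≢μx ◅ ε

  record Symmetry : Set where
    field
      to from : V → V
      from-to : ∀ x → from (to x) ≡ x
      to-from : ∀ x → to (from x) ≡ x
      to-up : ∀ x → to (up x) ≡ up (to x)
      to-hor : ∀ x → to (hor x) ≡ hor (to x)

    to-down : ∀ x → to (down x) ≡ down (to x)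
    to-down x = begin
      to (down x)             ≡⟨ down-up _ ⟨
      down (up (to (down x))) ≡⟨ cong down (to-up (down x)) ⟨
      down (to (up (down x))) ≡⟨ cong (down ∘ to) (up-down x) ⟩
      down (to x)             ∎
      where open ≡-Reasoning

    to-nbr : ∀ x d → to (nbr x d) ≡ nbr (to x) d
    to-nbr x ↑ = to-up x
    to-nbr x ↓ = to-down x
    to-nbr x ⇄ = to-hor x

    to-adj : ∀ {x y} → Adjacent x y → Adjacent (to x) (to y)
    to-adj {x} xy with adj⇒nbr xy
    ... | d , refl = subst (Adjacent (to x)) (sym (to-nbr x d)) (nbr-adj (to x) d)

    from-commutes : ∀ {f : V → V} → (∀ x → to (f x) ≡ f (to x)) → ∀ x → from (f x) ≡ f (from x)
    from-commutes {f} to-f x = begin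
      from (f x)               ≡⟨ cong (from ∘ f) (to-from x) ⟨
      from (f (to (from x)))   ≡⟨ cong from (to-f (from x)) ⟨
      from (to (f (from x)))   ≡⟨ from-to _ ⟩
      f (from x)               ∎
      where open ≡-Reasoning

  open Symmetry public

  inverse : Symmetry → Symmetry
  inverse σ = record
    { to = from σ ; from = to σ ; from-to = to-from σ ; to-from = from-to σ
    ; to-up = from-commutes σ (to-up σ) ; to-hor = from-commutes σ (to-hor σ) }

  _∘ₛ_ : Symmetry → Symmetry → Symmetry
  σ ∘ₛ ρ = record
    { to = to σ ∘ to ρ ; from = from ρ ∘ from σ
    ; from-to = λ x → trans (cong (from ρ) (from-to σ (to ρ x))) (from-to ρ x)
    ; to-from = λ x → trans (cong (to σ) (to-from ρ (from σ x))) (to-from σ x)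
    ; to-up = λ x → trans (cong (to σ) (to-up ρ x)) (to-up σ (to ρ x))
    ; to-hor = λ x → trans (cong (to σ) (to-hor ρ x)) (to-hor σ (to ρ x)) }

  identity : Symmetry
  identity = record
    { to = λ x → x ; from = λ x → x ; from-to = λ _ → refl ; to-from = λ _ → refl
    ; to-up = λ _ → refl ; to-hor = λ _ → refl }

  shift² : Symmetry
  shift² = record
    { to = up² ; from = down ∘ down
    ; from-to = λ x → trans (cong down (down-up (up x))) (down-up x)
    ; to-from = λ x → trans (cong up (up-down (down x))) (up-down x)
    ; to-up = λ _ → refl ; to-hor = λ x → sym (hor-up² x) }

  -- One column to the right and one row up.
  diagonalBy undiagonalBy : Bool → V → V
  diagonalBy true x = up (hor x)
  diagonalBy false x = hor (up x)
  undiagonalBy true y = hor (down y)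
  undiagonalBy false y = down (hor y)

  private
    colour-diagonalBy : ∀ b x → colour x ≡ b → colour (diagonalBy b x) ≡ b
    colour-diagonalBy true x c = trans (colour-up (hor x)) (trans (cong not (colour-hor x)) (trans (not-involutive _) c))
    colour-diagonalBy false x c = trans (colour-hor (up x)) (trans (cong not (colour-up x)) (trans (not-involutive _) c))

    colour-undiagonalBy : ∀ b x → colour x ≡ b → colour (undiagonalBy b x) ≡ b
    colour-undiagonalBy true x c = trans (colour-hor (down x)) (trans (cong not (colour-down x)) (trans (not-involutive _) c))
    colour-undiagonalBy false x c = trans (colour-down (hor x)) (trans (cong not (colour-hor x)) (trans (not-involutive _) c))

  diagonal-to diagonal-from : V → V
  diagonal-to x = diagonalBy (colour x) x
  diagonal-from y = undiagonalBy (colour y) y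

  private
    diagonal-to≡ : ∀ x b → colour x ≡ b → diagonal-to x ≡ diagonalBy b x
    diagonal-to≡ x b c = cong (λ b → diagonalBy b x) c

    diagonal-from≡ : ∀ x b → colour x ≡ b → diagonal-from x ≡ undiagonalBy b x
    diagonal-from≡ x b c = cong (λ b → undiagonalBy b x) c

    diagonal-from-to : ∀ x → diagonal-from (diagonal-to x) ≡ x
    diagonal-from-to x = by-colour (colour x) refl
      where
        by-colour : ∀ b → colour x ≡ b → diagonal-from (diagonal-to x) ≡ x
        by-colour true c = begin
          diagonal-from (diagonal-to x)  ≡⟨ cong diagonal-from (diagonal-to≡ x true c) ⟩
          diagonal-from (up (hor x))     ≡⟨ diagonal-from≡ (up (hor x)) true (colour-diagonalBy true x c) ⟩
          hor (down (up (hor x)))        ≡⟨ cong hor (down-up (hor x)) ⟩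
          hor (hor x)                    ≡⟨ hor-involutive x ⟩
          x                              ∎
          where open ≡-Reasoning
        by-colour false c = begin
          diagonal-from (diagonal-to x)  ≡⟨ cong diagonal-from (diagonal-to≡ x false c) ⟩
          diagonal-from (hor (up x))     ≡⟨ diagonal-from≡ (hor (up x)) false (colour-diagonalBy false x c) ⟩
          down (hor (hor (up x)))        ≡⟨ cong down (hor-involutive (up x)) ⟩
          down (up x)                    ≡⟨ down-up x ⟩
          x                              ∎
          where open ≡-Reasoning

    diagonal-to-from : ∀ y → diagonal-to (diagonal-from y) ≡ y
    diagonal-to-from y = by-colour (colour y) refl
      where
        by-colour : ∀ b → colour y ≡ b → diagonal-to (diagonal-from y) ≡ y
        by-colour true c = begin
          diagonal-to (diagonal-from y)  ≡⟨ cong diagonal-to (diagonal-from≡ y true c) ⟩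
          diagonal-to (hor (down y))     ≡⟨ diagonal-to≡ (hor (down y)) true (colour-undiagonalBy true y c) ⟩
          up (hor (hor (down y)))        ≡⟨ cong up (hor-involutive (down y)) ⟩
          up (down y)                    ≡⟨ up-down y ⟩
          y                              ∎
          where open ≡-Reasoning
        by-colour false c = begin
          diagonal-to (diagonal-from y)  ≡⟨ cong diagonal-to (diagonal-from≡ y false c) ⟩
          diagonal-to (down (hor y))     ≡⟨ diagonal-to≡ (down (hor y)) false (colour-undiagonalBy false y c) ⟩
          hor (up (down (hor y)))        ≡⟨ cong hor (up-down (hor y)) ⟩
          hor (hor y)                    ≡⟨ hor-involutive y ⟩
          y                              ∎
          where open ≡-Reasoning

    diagonal-up : ∀ x → diagonal-to (up x) ≡ up (diagonal-to x)
    diagonal-up x = by-colour (colour x) refl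
      where
        by-colour : ∀ b → colour x ≡ b → diagonal-to (up x) ≡ up (diagonal-to x)
        by-colour true c = begin
          diagonal-to (up x)    ≡⟨ diagonal-to≡ (up x) false (trans (colour-up x) (cong not c)) ⟩
          hor (up (up x))       ≡⟨ hor-up² x ⟩
          up (up (hor x))       ≡⟨ cong up (diagonal-to≡ x true c) ⟨
          up (diagonal-to x)    ∎
          where open ≡-Reasoning
        by-colour false c = begin
          diagonal-to (up x)    ≡⟨ diagonal-to≡ (up x) true (trans (colour-up x) (cong not c)) ⟩
          up (hor (up x))       ≡⟨ cong up (diagonal-to≡ x false c) ⟨
          up (diagonal-to x)    ∎
          where open ≡-Reasoning

    diagonal-hor : ∀ x → diagonal-to (hor x) ≡ hor (diagonal-to x)
    diagonal-hor x = by-colour (colour x) refl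
      where
        by-colour : ∀ b → colour x ≡ b → diagonal-to (hor x) ≡ hor (diagonal-to x)
        by-colour true c = begin
          diagonal-to (hor x)   ≡⟨ diagonal-to≡ (hor x) false (trans (colour-hor x) (cong not c)) ⟩
          hor (up (hor x))      ≡⟨ cong hor (diagonal-to≡ x true c) ⟨
          hor (diagonal-to x)   ∎
          where open ≡-Reasoning
        by-colour false c = begin
          diagonal-to (hor x)   ≡⟨ diagonal-to≡ (hor x) true (trans (colour-hor x) (cong not c)) ⟩
          up (hor (hor x))      ≡⟨ cong up (hor-involutive x) ⟩
          up x                  ≡⟨ hor-involutive (up x) ⟨
          hor (hor (up x))      ≡⟨ cong hor (diagonal-to≡ x false c) ⟨
          hor (diagonal-to x)   ∎
          where open ≡-Reasoning

  diagonal : Symmetry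
  diagonal = record
    { to = diagonal-to ; from = diagonal-from ; from-to = diagonal-from-to ; to-from = diagonal-to-from
    ; to-up = diagonal-up ; to-hor = diagonal-hor }

  shift²-pt : ∀ i j → to shift² (pt i j) ≡ pt i (2 + j)
  shift²-pt i j = trans (cong up (up-pt i j)) (up-pt i (suc j))

  diagonal-pt : ∀ {i} j → suc i < m → to diagonal (pt i j) ≡ pt (suc i) (suc j)
  diagonal-pt {i} j i+1<m = by-colour (odd (i + j)) refl
    where
      open ≡-Reasoning
      colour≡ : ∀ c → odd (i + j) ≡ c → colour (pt i j) ≡ c
      colour≡ c e = trans (colour-pt j (≤-trans (n≤1+n _) i+1<m)) e
      by-colour : ∀ c → odd (i + j) ≡ c → diagonal-to (pt i j) ≡ pt (suc i) (suc j)
      by-colour true odd = begin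
        diagonal-to (pt i j)   ≡⟨ diagonal-to≡ (pt i j) true (colour≡ true odd) ⟩
        up (hor (pt i j))      ≡⟨ cong up (hor-pt-right j i+1<m odd) ⟩
        up (pt (suc i) j)      ≡⟨ up-pt (suc i) j ⟩
        pt (suc i) (suc j)     ∎
      by-colour false even = begin
        diagonal-to (pt i j)   ≡⟨ diagonal-to≡ (pt i j) false (colour≡ false even) ⟩
        hor (up (pt i j))      ≡⟨ cong hor (up-pt i j) ⟩
        hor (pt i (suc j))     ≡⟨ hor-pt-right (suc j) i+1<m (trans (cong odd (+-suc i j)) (cong not even)) ⟩
        pt (suc i) (suc j)     ∎

  Image : V → Set
  Image x = (∃ λ σ → to σ (pt 1 3) ≡ x) ⊎ (∃ λ σ → to σ (pt 1 4) ≡ x)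

  Image-to : ∀ σ {x} → Image x → Image (to σ x)
  Image-to σ = Sum.map (λ (ρ , e) → σ ∘ₛ ρ , cong (to σ) e) (λ (ρ , e) → σ ∘ₛ ρ , cong (to σ) e)

  Image-≡ : ∀ {x y} → x ≡ y → Image x → Image y
  Image-≡ refl image = image

  private
    1<m : 1 < m
    1<m = s≤s (n≢0⇒n>0 m₀≢0)

    image-column-1 : ∀ k → Image (pt 1 (3 + k))
    image-column-1 0 = inj₁ (identity , refl)
    image-column-1 1 = inj₂ (identity , refl)
    image-column-1 (suc (suc k)) = Image-≡ (shift²-pt 1 (3 + k)) (Image-to shift² (image-column-1 k))

    n≡3+ : n ≡ 3 + (n₀ ∸ 2)
    n≡3+ = cong suc (sym (m+[n∸m]≡n 2≤n₀))

  image : ∀ i j → i < m → Image (pt i j)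
  image 0 j _ = Image-≡ (trans (cong (from diagonal) (sym (diagonal-pt j 1<m))) (from-to diagonal (pt 0 j)))
                        (Image-to (inverse diagonal) (image 1 (suc j) 1<m))
  image 1 j _ = Image-≡ (pt-periodic 1 j) (subst (Image ∘ pt 1) (sym (cong (_+ j) n≡3+)) (image-column-1 (n₀ ∸ 2 + j)))
  image (suc (suc i)) j i+2<m = Image-≡ (trans (diagonal-pt (n₀ + j) i+2<m) (pt-periodic (suc (suc i)) j))
                                       (Image-to diagonal (image (suc i) (n₀ + j) (≤-trans (n≤1+n _) i+2<m)))

  every-vertex-image : ∀ x → Image x
  every-vertex-image x = Image-≡ (pt-col-row x) (image (col x) (row x) (Fin.toℕ<n (proj₁ x)))

  Separating2Factor-from : ∀ σ {u v} → Separating2Factor Adjacent (from σ u) (from σ v) → Separating2Factor Adjacent u v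
  Separating2Factor-from σ {u} {v} sep = subst₂ (Separating2Factor Adjacent) (to-from σ u) (to-from σ v)
    (Separating2Factor-transport (to σ) (from σ) (from-to σ) (to-from σ) (to-adj σ) sep)

  Splits : (V → Bool) → V → V → Set
  Splits S c y = ∃ λ κ → S (from κ c) ≢ S (from κ y)

  -- Move u to the base point c by σ, then split c from the image of v by a second symmetry κ.
  separated-via-base : (S : V → Bool) → (∀ {u v} → S u ≢ S v → Separating2Factor Adjacent u v) →
    ∀ σ {c u v} → u ≢ v → to σ c ≡ u → (∀ y → y ≢ c → Splits S c y) → Separating2Factor Adjacent u v
  separated-via-base S separates σ {c} {v = v} u≢v refl splits with splits (from σ v) v≢c
    where
      v≢c : from σ v ≢ c
      v≢c v≡c = u≢v (trans (cong (to σ) (sym v≡c)) (to-from σ v))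
  ... | κ , split = Separating2Factor-from (σ ∘ₛ κ)
        (separates (subst (λ z → S (from κ z) ≢ S (from κ (from σ v))) (sym (from-to σ c)) split))

  two-spanning-cyclable-by-splitting : (S : V → Bool) → (∀ {u v} → S u ≢ S v → Separating2Factor Adjacent u v) →
    (∀ y → y ≢ pt 1 3 → Splits S (pt 1 3) y) → (∀ y → y ≢ pt 1 4 → Splits S (pt 1 4) y) →
    TwoSpanningCyclable V Adjacent
  two-spanning-cyclable-by-splitting S separates splits₃ splits₄ u v u≢v with every-vertex-image u
  ... | inj₁ (σ , σc≡u) = separated-via-base S separates σ u≢v σc≡u splits₃
  ... | inj₂ (σ , σc≡u) = separated-via-base S separates σ u≢v σc≡u splits₄

module HTG-2-4 where

  open Honeycomb 1 3 refl refl (s≤s (s≤s z≤n))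

  -- Three perfect matchings: the flat edges, and two ways of pairing the vertical edges.
  flats verticals₁ verticals₂ : V → Dir
  flats _ = ⇄
  verticals₁ (0F , 0F) = ↓
  verticals₁ (0F , 1F) = ↑
  verticals₁ (0F , 2F) = ↓
  verticals₁ (0F , 3F) = ↑
  verticals₁ (1F , 0F) = ↑
  verticals₁ (1F , 1F) = ↓
  verticals₁ (1F , 2F) = ↑
  verticals₁ (1F , 3F) = ↓
  verticals₂ (0F , 0F) = ↑
  verticals₂ (0F , 1F) = ↓
  verticals₂ (0F , 2F) = ↑
  verticals₂ (0F , 3F) = ↓
  verticals₂ (1F , 0F) = ↓
  verticals₂ (1F , 1F) = ↑
  verticals₂ (1F , 2F) = ↓
  verticals₂ (1F , 3F) = ↑

  side₀ side₁ side₂ : V → Bool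
  side₀ (0F , _) = true
  side₀ (1F , _) = false
  side₁ (0F , 0F) = true
  side₁ (0F , 1F) = true
  side₁ (0F , 2F) = false
  side₁ (0F , 3F) = false
  side₁ (1F , 0F) = false
  side₁ (1F , 1F) = true
  side₁ (1F , 2F) = true
  side₁ (1F , 3F) = false
  side₂ (0F , 0F) = false
  side₂ (0F , 1F) = true
  side₂ (0F , 2F) = true
  side₂ (0F , 3F) = false
  side₂ (1F , 0F) = true
  side₂ (1F , 1F) = true
  side₂ (1F , 2F) = false
  side₂ (1F , 3F) = false

  decode : Bool → Bool → Bool → V
  decode true true false = 0F , 0F
  decode true true true = 0F , 1F
  decode true false true = 0F , 2F
  decode true false false = 0F , 3F
  decode false false true = 1F , 0F
  decode false true true = 1F , 1F
  decode false true false = 1F , 2F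
  decode false false false = 1F , 3F

  decode-sides : ∀ x → decode (side₀ x) (side₁ x) (side₂ x) ≡ x
  decode-sides (0F , 0F) = refl
  decode-sides (0F , 1F) = refl
  decode-sides (0F , 2F) = refl
  decode-sides (0F , 3F) = refl
  decode-sides (1F , 0F) = refl
  decode-sides (1F , 1F) = refl
  decode-sides (1F , 2F) = refl
  decode-sides (1F , 3F) = refl

  ∀-vertex : {P : V → Set} → P (0F , 0F) → P (0F , 1F) → P (0F , 2F) → P (0F , 3F) →
             P (1F , 0F) → P (1F , 1F) → P (1F , 2F) → P (1F , 3F) → ∀ x → P x
  ∀-vertex p₀₀ _ _ _ _ _ _ _ (0F , 0F) = p₀₀
  ∀-vertex _ p₀₁ _ _ _ _ _ _ (0F , 1F) = p₀₁
  ∀-vertex _ _ p₀₂ _ _ _ _ _ (0F , 2F) = p₀₂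
  ∀-vertex _ _ _ p₀₃ _ _ _ _ (0F , 3F) = p₀₃
  ∀-vertex _ _ _ _ p₁₀ _ _ _ (1F , 0F) = p₁₀
  ∀-vertex _ _ _ _ _ p₁₁ _ _ (1F , 1F) = p₁₁
  ∀-vertex _ _ _ _ _ _ p₁₂ _ (1F , 2F) = p₁₂
  ∀-vertex _ _ _ _ _ _ _ p₁₃ (1F , 3F) = p₁₃

  flats-perfect : IsPerfectMatching flats
  flats-perfect = perfect-matching (∀-vertex refl refl refl refl refl refl refl refl)

  verticals₁-perfect : IsPerfectMatching verticals₁
  verticals₁-perfect = perfect-matching (∀-vertex refl refl refl refl refl refl refl refl)

  verticals₂-perfect : IsPerfectMatching verticals₂
  verticals₂-perfect = perfect-matching (∀-vertex refl refl refl refl refl refl refl refl)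

  side₀-stable : ∀ x d → d ≢ flats x → side₀ (nbr x d) ≡ side₀ x
  side₀-stable = stable-from-others side₀ (∀-vertex (refl , refl) (refl , refl) (refl , refl) (refl , refl)
                                                    (refl , refl) (refl , refl) (refl , refl) (refl , refl))

  side₁-stable : ∀ x d → d ≢ verticals₁ x → side₁ (nbr x d) ≡ side₁ x
  side₁-stable = stable-from-others side₁ (∀-vertex (refl , refl) (refl , refl) (refl , refl) (refl , refl)
                                                    (refl , refl) (refl , refl) (refl , refl) (refl , refl))

  side₂-stable : ∀ x d → d ≢ verticals₂ x → side₂ (nbr x d) ≡ side₂ x
  side₂-stable = stable-from-others side₂ (∀-vertex (refl , refl) (refl , refl) (refl , refl) (refl , refl)
                                                    (refl , refl) (refl , refl) (refl , refl) (refl , refl))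


  base₀ base₁ base₂ : Bool → V
  base₀ b = (if b then 0F else 1F) , 0F
  base₁ b = 0F , (if b then 0F else 2F)
  base₂ b = 0F , (if b then 1F else 0F)

  side₀-connected : ∀ w → Star (Unmatched flats) (base₀ (side₀ w)) w
  side₀-connected = ∀-vertex
    ε (step (0F , 0F) ↑ (λ ())) (step (0F , 0F) ↑ (λ ()) ◅◅ step (0F , 1F) ↑ (λ ())) (step (0F , 0F) ↓ (λ ()))
    ε (step (1F , 0F) ↑ (λ ())) (step (1F , 0F) ↑ (λ ()) ◅◅ step (1F , 1F) ↑ (λ ())) (step (1F , 0F) ↓ (λ ()))
    where open Steps flats

  side₁-connected : ∀ w → Star (Unmatched verticals₁) (base₁ (side₁ w)) w
  side₁-connected = ∀-vertex
    ε (step (0F , 0F) ↑ (λ ())) ε (step (0F , 2F) ↑ (λ ()))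
    (step (0F , 2F) ⇄ (λ ())) (step (0F , 0F) ⇄ (λ ()) ◅◅ step (1F , 2F) ↓ (λ ())) (step (0F , 0F) ⇄ (λ ()))
    (step (0F , 2F) ⇄ (λ ()) ◅◅ step (1F , 0F) ↓ (λ ()))
    where open Steps verticals₁

  side₂-connected : ∀ w → Star (Unmatched verticals₂) (base₂ (side₂ w)) w
  side₂-connected = ∀-vertex
    ε ε (step (0F , 1F) ↑ (λ ())) (step (0F , 0F) ↓ (λ ()))
    (step (0F , 1F) ⇄ (λ ()) ◅◅ step (1F , 1F) ↓ (λ ())) (step (0F , 1F) ⇄ (λ ())) (step (0F , 0F) ⇄ (λ ()))
    (step (0F , 0F) ⇄ (λ ()) ◅◅ step (1F , 2F) ↑ (λ ()))
    where open Steps verticals₂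

  sides-injective : ∀ {u v} → side₀ u ≡ side₀ v → side₁ u ≡ side₁ v → side₂ u ≡ side₂ v → u ≡ v
  sides-injective {u} {v} e₀ e₁ e₂ = begin
    u                                    ≡⟨ decode-sides u ⟨
    decode (side₀ u) (side₁ u) (side₂ u) ≡⟨ cong (λ a → decode a (side₁ u) (side₂ u)) e₀ ⟩
    decode (side₀ v) (side₁ u) (side₂ u) ≡⟨ cong₂ (decode (side₀ v)) e₁ e₂ ⟩
    decode (side₀ v) (side₁ v) (side₂ v) ≡⟨ decode-sides v ⟩
    v                                    ∎
    where open ≡-Reasoning

  two-spanning-cyclable : HTG-2SC 2 4 2
  two-spanning-cyclable u v u≢v with side₀ u Bool.≟ side₀ v | side₁ u Bool.≟ side₁ v | side₂ u Bool.≟ side₂ v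
  ... | no ≢₀ | _ | _ = unmatched-separating flats-perfect side₀ side₀-stable base₀ side₀-connected ≢₀
  ... | yes _ | no ≢₁ | _ = unmatched-separating verticals₁-perfect side₁ side₁-stable base₁ side₁-connected ≢₁
  ... | yes _ | yes _ | no ≢₂ = unmatched-separating verticals₂-perfect side₂ side₂-stable base₂ side₂-connected ≢₂
  ... | yes ≡₀ | yes ≡₁ | yes ≡₂ = contradiction (sides-injective ≡₀ ≡₁ ≡₂) u≢v

-- HTG(2, 6 + 2s, 2): square k is (1 , 2k) (1 , 2k + 1) (0 , 2k + 1) (0 , 2k + 2).
module TwoColumns (s : ℕ) where

  n₀-odd : odd (5 + double s) ≡ true
  n₀-odd = cong (not ∘ not ∘ not ∘ not ∘ not) (odd-double s)

  open Honeycomb 1 (5 + double s) refl n₀-odd (s≤s (s≤s z≤n))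

  square : ℕ → Square Adjacent
  square k = record
    { p = pt 1 (double k) ; q = pt 1 (1 + double k) ; r = pt 0 (1 + double k) ; s = pt 0 (2 + double k)
    ; p′ = down (pt 1 (double k)) ; q′ = up (pt 1 (1 + double k))
    ; r′ = down (pt 0 (1 + double k)) ; s′ = up (pt 0 (2 + double k))
    ; p-nbrs = nbr-neighbours _ ↑ ⇄ ↓ (up-pt 1 (double k)) (hor-pt-jump (double k) (odd-double k)) refl
                              (λ ()) (λ ()) (λ ())
    ; q-nbrs = nbr-neighbours _ ↓ ⇄ ↑ (down-pt 1 (double k))
                              (hor-pt-left (1 + double k) ≤-refl (cong (not ∘ not) (odd-double k))) refl
                              (λ ()) (λ ()) (λ ())
    ; r-nbrs = nbr-neighbours _ ⇄ ↑ ↓ (hor-pt-right (1 + double k) ≤-refl (cong not (odd-double k)))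
                              (up-pt 0 (1 + double k)) refl (λ ()) (λ ()) (λ ())
    ; s-nbrs = nbr-neighbours _ ↓ ⇄ ↑ (down-pt 0 (1 + double k)) (hor-pt-jump-back (double k) (odd-double k)) refl
                              (λ ()) (λ ()) (λ ()) }

  rungs : ∀ k → Rungs (square k) (square (suc k))
  rungs k = record
    { q′≡p = up-pt 1 (1 + double k) ; p′≡q = down-pt 1 (1 + double k)
    ; s′≡r = up-pt 0 (2 + double k) ; r′≡s = down-pt 0 (2 + double k) }

  pt₂∉ : ¬ (pt 1 4 ∈□ square 0 ⊎ pt 1 4 ∈□ square 1)
  pt₂∉ (inj₁ (inj₁ ()))
  pt₂∉ (inj₁ (inj₂ (inj₁ ())))
  pt₂∉ (inj₁ (inj₂ (inj₂ (inj₁ ()))))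
  pt₂∉ (inj₁ (inj₂ (inj₂ (inj₂ ()))))
  pt₂∉ (inj₂ (inj₁ ()))
  pt₂∉ (inj₂ (inj₂ (inj₁ ())))
  pt₂∉ (inj₂ (inj₂ (inj₂ (inj₁ ()))))
  pt₂∉ (inj₂ (inj₂ (inj₂ (inj₂ ()))))

  not-two-spanning-cyclable : ¬ HTG-2SC 2 (6 + double s) 2
  not-two-spanning-cyclable 2sc =
    ladder-not-separating square (1 + s) (λ k _ → rungs k) (square (3 + s)) (rungs (2 + s))
      (inj₁ (sym (trans (cong (pt 0) (+-comm 2 (6 + double s))) (pt-periodic 0 2))))
      (pt 1 4) pt₂∉ (2sc (pt 0 2) (pt 0 3) (λ ()))

-- HTG(4 + 2t, 4, 2): the squares are the columns, consecutive columns being joined by two flat edges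
-- and the last column to the first by two jump edges.
module FourRows (t : ℕ) where

  m₀-odd : odd (3 + double t) ≡ true
  m₀-odd = cong (not ∘ not ∘ not) (odd-double t)

  open Honeycomb (3 + double t) 3 m₀-odd refl (s≤s (s≤s z≤n))

  column-square : ℕ → ℕ → Square Adjacent
  column-square c j = record
    { p = pt c j ; q = pt c (1 + j) ; r = pt c (2 + j) ; s = pt c (3 + j)
    ; p′ = hor (pt c j) ; q′ = hor (pt c (1 + j)) ; r′ = hor (pt c (2 + j)) ; s′ = hor (pt c (3 + j))
    ; p-nbrs = nbr-neighbours _ ↑ ↓ ⇄ (up-pt c j) (trans (cong down (sym (pt-periodic c j))) (down-pt c (3 + j))) refl
                              (λ ()) (λ ()) (λ ())
    ; q-nbrs = nbr-neighbours _ ↓ ↑ ⇄ (down-pt c j) (up-pt c (1 + j)) refl (λ ()) (λ ()) (λ ())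
    ; r-nbrs = nbr-neighbours _ ↓ ↑ ⇄ (down-pt c (1 + j)) (up-pt c (2 + j)) refl (λ ()) (λ ()) (λ ())
    ; s-nbrs = nbr-neighbours _ ↓ ↑ ⇄ (down-pt c (2 + j)) (trans (up-pt c (3 + j)) (pt-periodic c j)) refl
                              (λ ()) (λ ()) (λ ()) }

  square : ℕ → Square Adjacent
  square k = column-square k k

  rungs : ∀ k → suc k ≤ 3 + double t → Rungs (square k) (square (suc k))
  rungs k k<m₀ = record
    { q′≡p = hor-pt-right (1 + k) (s≤s k<m₀) (odd-sandwich k 1)
    ; p′≡q = hor-pt-left (suc k) (s≤s k<m₀) (odd-sandwich (suc k) 0)
    ; s′≡r = hor-pt-right (3 + k) (s≤s k<m₀) (odd-sandwich k 3)
    ; r′≡s = hor-pt-left (3 + k) (s≤s k<m₀) (odd-sandwich (suc k) 2) }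

  wrap : Square Adjacent
  wrap = column-square 0 (6 + double t)

  wrap-rungs : Rungs (square (3 + double t)) wrap
  wrap-rungs = record
    { q′≡p = hor-pt-jump (4 + double t) (cong not m₀-odd)
    ; p′≡q = hor-pt-jump-back (4 + double t) (cong not m₀-odd)
    ; s′≡r = hor-pt-jump (6 + double t) (cong (not ∘ not ∘ not) m₀-odd)
    ; r′≡s = hor-pt-jump-back (6 + double t) (cong (not ∘ not ∘ not) m₀-odd) }

  pt-periodic⁴ : ∀ c w j → pt c (double (double w) + j) ≡ pt c j
  pt-periodic⁴ c zero j = refl
  pt-periodic⁴ c (suc w) j = trans (pt-periodic c (double (double w) + j)) (pt-periodic⁴ c w j)

  -- Whether the ladder closes with a twist depends on m₀ modulo 4.
  wraps : pt 0 3 ≡ Square.s wrap ⊎ pt 0 3 ≡ Square.q wrap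
  wraps with parity-split t
  ... | w , inj₁ refl = inj₂ (sym (begin
    pt 0 (7 + double (double w))   ≡⟨ cong (pt 0) (+-comm 7 (double (double w))) ⟩
    pt 0 (double (double w) + 7)   ≡⟨ pt-periodic⁴ 0 w 7 ⟩
    pt 0 7                         ≡⟨ pt-periodic 0 3 ⟩
    pt 0 3                         ∎))
    where open ≡-Reasoning
  ... | w , inj₂ refl = inj₁ (sym (begin
    pt 0 (11 + double (double w))  ≡⟨ cong (pt 0) (+-comm 11 (double (double w))) ⟩
    pt 0 (double (double w) + 11)  ≡⟨ pt-periodic⁴ 0 w 11 ⟩
    pt 0 11                        ≡⟨ pt-periodic 0 7 ⟩
    pt 0 7                         ≡⟨ pt-periodic 0 3 ⟩
    pt 0 3                         ∎))
    where open ≡-Reasoning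

  pt₂∉ : ¬ (pt 2 2 ∈□ square 0 ⊎ pt 2 2 ∈□ square 1)
  pt₂∉ (inj₁ (inj₁ ()))
  pt₂∉ (inj₁ (inj₂ (inj₁ ())))
  pt₂∉ (inj₁ (inj₂ (inj₂ (inj₁ ()))))
  pt₂∉ (inj₁ (inj₂ (inj₂ (inj₂ ()))))
  pt₂∉ (inj₂ (inj₁ ()))
  pt₂∉ (inj₂ (inj₂ (inj₁ ())))
  pt₂∉ (inj₂ (inj₂ (inj₂ (inj₁ ()))))
  pt₂∉ (inj₂ (inj₂ (inj₂ (inj₂ ()))))

  not-two-spanning-cyclable : ¬ HTG-2SC (4 + double t) 4 2
  not-two-spanning-cyclable 2sc =
    ladder-not-separating square (2 + double t) (λ k k≤ → rungs k (s≤s k≤)) wrap wrap-rungs wraps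
      (pt 2 2) pt₂∉ (2sc (pt 0 3) (pt 1 3) (λ ()))

byColumn : Dir → Dir → Dir → Dir → ℕ → Dir
byColumn d₀ d₁ d₂ d₃ 0 = d₀
byColumn d₀ d₁ d₂ d₃ 1 = d₁
byColumn d₀ d₁ d₂ d₃ 2 = d₂
byColumn d₀ d₁ d₂ d₃ (suc (suc (suc _))) = d₃

middle : Bool → ℕ → Dir
middle false = byColumn ↑ ↑ ↑ ↓
middle true = byColumn ↓ ↓ ↓ ↑

middle-not : ∀ b i → middle (not b) i ≡ opp (middle b i)
middle-not false 0 = refl
middle-not false 1 = refl
middle-not false 2 = refl
middle-not false (suc (suc (suc _))) = refl
middle-not true 0 = refl
middle-not true 1 = refl
middle-not true 2 = refl
middle-not true (suc (suc (suc _))) = refl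

-- HTG(4 + 2a, 6 + 2b, 2) with columns 0 … m₀ and rows 0 … n₀.
module Large (a b : ℕ) where

  m₀ n₀ : ℕ
  m₀ = 3 + double a
  n₀ = 5 + double b

  m₀-odd : odd m₀ ≡ true
  m₀-odd = cong (not ∘ not ∘ not) (odd-double a)

  n₀-odd : odd n₀ ≡ true
  n₀-odd = cong (not ∘ not ∘ not ∘ not ∘ not) (odd-double b)

  open Honeycomb m₀ n₀ m₀-odd n₀-odd (s≤s (s≤s z≤n)) public

  -- label i j is the direction of the matching edge at (i , j). In the columns 0, 1, 2 it pairs the rows
  -- (3 4) (5 6) … (n₀ - 2 , n₀ - 1), in the columns from 3 on the rows (2 3) (4 5) … (n₀ - 1 , n₀), and
  -- moreover (0 1) in the columns 0, 1 and (n₀ 0) in column 2; all other vertices are matched along flat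
  -- and jump edges.
  label : ℕ → ℕ → Dir
  label i 0 = byColumn ↑ ↑ ↓ ⇄ i
  label i 1 = byColumn ↓ ↓ ⇄ ⇄ i
  label i 2 = byColumn ⇄ ⇄ ⇄ ↑ i
  label i (suc (suc (suc k))) with k ≟ 2 + double b
  ... | yes _ = byColumn ⇄ ⇄ ↑ ↓ i
  ... | no _ = middle (odd k) i

  label-top : ∀ i → label i n₀ ≡ byColumn ⇄ ⇄ ↑ ↓ i
  label-top i with 2 + double b ≟ 2 + double b
  ... | yes _ = refl
  ... | no ≢ = contradiction refl ≢

  label-middle : ∀ i k → k ≢ 2 + double b → label i (3 + k) ≡ middle (odd k) i
  label-middle i k k≢ with k ≟ 2 + double b
  ... | yes k≡ = contradiction k≡ k≢
  ... | no _ = refl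

  μ₀ : V → Dir
  μ₀ x = label (col x) (row x)

  private
    odd-below-top : ∀ {k} → suc k ≡ 2 + double b → odd k ≡ true
    odd-below-top refl = cong not (odd-double b)

    top-below-↑ : ∀ i → middle true i ≡ ↑ → byColumn ⇄ ⇄ ↑ ↓ i ≡ ↓
    top-below-↑ (suc (suc (suc _))) _ = refl

    top-above-↓ : ∀ i → byColumn ⇄ ⇄ ↑ ↓ i ≡ ↓ → middle true i ≡ ↑
    top-above-↓ (suc (suc (suc _))) _ = refl

    label-next-middle : ∀ i k → suc k ≢ 2 + double b → label i (4 + k) ≡ opp (middle (odd k) i)
    label-next-middle i k k+1≢ = trans (label-middle i (suc k) k+1≢) (middle-not (odd k) i)

  ↑-then-↓ : ∀ i j → j < n₀ → label i j ≡ ↑ → label i (suc j) ≡ ↓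
  ↑-then-↓ 0 0 _ _ = refl
  ↑-then-↓ 1 0 _ _ = refl
  ↑-then-↓ (suc (suc (suc _))) 2 _ _ = refl
  ↑-then-↓ i (suc (suc (suc k))) j<n₀ ↑at = next (suc k ≟ 2 + double b)
    where
      middle≡↑ : middle (odd k) i ≡ ↑
      middle≡↑ = trans (sym (label-middle i k (<⇒≢ (≤-pred (≤-pred (≤-pred j<n₀)))))) ↑at
      next : Dec (suc k ≡ 2 + double b) → label i (4 + k) ≡ ↓
      next (yes k+1≡) = trans (cong (λ r → label i (3 + r)) k+1≡) (trans (label-top i)
        (top-below-↑ i (trans (cong (λ c → middle c i) (sym (odd-below-top k+1≡))) middle≡↑)))
      next (no k+1≢) = trans (label-next-middle i k k+1≢) (cong opp middle≡↑)

  ↓-then-↑ : ∀ i j → j < n₀ → label i (suc j) ≡ ↓ → label i j ≡ ↑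
  ↓-then-↑ 0 0 _ _ = refl
  ↓-then-↑ 1 0 _ _ = refl
  ↓-then-↑ (suc (suc (suc _))) 2 _ _ = refl
  ↓-then-↑ i (suc (suc (suc k))) j<n₀ ↓above = trans (label-middle i k (<⇒≢ (≤-pred (≤-pred (≤-pred j<n₀))))) (previous (suc k ≟ 2 + double b))
    where
      previous : Dec (suc k ≡ 2 + double b) → middle (odd k) i ≡ ↑
      previous (yes k+1≡) = trans (cong (λ c → middle c i) (odd-below-top k+1≡))
        (top-above-↓ i (trans (sym (label-top i)) (trans (cong (λ r → label i (3 + r)) (sym k+1≡)) ↓above)))
      previous (no k+1≢) = trans (sym (opp-involutive _)) (cong opp (trans (sym (label-next-middle i k k+1≢)) ↓above))

  ↑-at-top : ∀ i → label i n₀ ≡ ↑ → label i 0 ≡ ↓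
  ↑-at-top i ↑at = lemma i (trans (sym (label-top i)) ↑at)
    where
      lemma : ∀ i → byColumn ⇄ ⇄ ↑ ↓ i ≡ ↑ → label i 0 ≡ ↓
      lemma 2 _ = refl

  ↓-at-bottom : ∀ i → label i 0 ≡ ↓ → label i n₀ ≡ ↑
  ↓-at-bottom 2 _ = label-top 2

  private
    middle≢⇄ : ∀ c i → middle c i ≢ ⇄
    middle≢⇄ false 0 ()
    middle≢⇄ false 1 ()
    middle≢⇄ false 2 ()
    middle≢⇄ false (suc (suc (suc _))) ()
    middle≢⇄ true 0 ()
    middle≢⇄ true 1 ()
    middle≢⇄ true 2 ()
    middle≢⇄ true (suc (suc (suc _))) ()

    ⇄-above-2 : ∀ i k → label i (3 + k) ≡ ⇄ → k ≡ 2 + double b × byColumn ⇄ ⇄ ↑ ↓ i ≡ ⇄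
    ⇄-above-2 i k ⇄at = by-row (k ≟ 2 + double b)
      where
        by-row : Dec (k ≡ 2 + double b) → k ≡ 2 + double b × byColumn ⇄ ⇄ ↑ ↓ i ≡ ⇄
        by-row (yes refl) = refl , trans (sym (label-top i)) ⇄at
        by-row (no k≢) = contradiction (trans (sym (label-middle i k k≢)) ⇄at) (middle≢⇄ (odd k) i)

    odd-1+n₀ : odd (1 + n₀) ≡ false
    odd-1+n₀ = cong not n₀-odd

  ⇄-right : ∀ i j → odd (i + j) ≡ true → label i j ≡ ⇄ → label (suc i) j ≡ ⇄
  ⇄-right (suc (suc (suc _))) 0 _ _ = refl
  ⇄-right 2 1 _ _ = refl
  ⇄-right (suc (suc (suc _))) 1 _ _ = refl
  ⇄-right 1 2 _ _ = refl
  ⇄-right i (suc (suc (suc k))) odd ⇄at with ⇄-above-2 i k ⇄at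
  ⇄-right 0 _ _ _ | refl , _ = label-top 1
  ⇄-right 1 _ odd _ | refl , _ = contradiction (trans (sym odd) odd-1+n₀) λ ()
  ⇄-right 2 _ _ _ | refl , ()
  ⇄-right (suc (suc (suc _))) _ _ _ | refl , ()

  ⇄-left : ∀ i j → odd (suc i + j) ≡ false → label (suc i) j ≡ ⇄ → label i j ≡ ⇄
  ⇄-left (suc (suc (suc _))) 0 _ _ = refl
  ⇄-left 2 1 _ _ = refl
  ⇄-left (suc (suc (suc _))) 1 _ _ = refl
  ⇄-left 1 2 _ _ = refl
  ⇄-left i (suc (suc (suc k))) _ ⇄at with ⇄-above-2 (suc i) k ⇄at
  ⇄-left 0 _ _ _ | refl , _ = label-top 0
  ⇄-left 1 _ _ _ | refl , ()
  ⇄-left (suc (suc _)) _ _ _ | refl , ()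

  ⇄-last-column : ∀ j → odd (m₀ + j) ≡ true → label m₀ j ≡ ⇄ → j ≡ 0
  ⇄-last-column 0 _ _ = refl
  ⇄-last-column 1 odd _ = contradiction (trans (sym odd) (trans (odd-+ m₀ 1) (cong (Data.Bool._xor true) m₀-odd))) λ ()
    where import Data.Bool
  ⇄-last-column (suc (suc (suc k))) _ ⇄at with ⇄-above-2 m₀ k ⇄at
  ... | refl , ()

  ⇄-first-column : ∀ j → odd j ≡ false → label 0 j ≡ ⇄ → j ≡ 2
  ⇄-first-column 2 _ _ = refl
  ⇄-first-column (suc (suc (suc k))) even ⇄at with ⇄-above-2 0 k ⇄at
  ... | refl , _ = contradiction (trans (sym even) n₀-odd) λ ()

  μ₀-pt : ∀ {i j} → i < m → j < n → μ₀ (pt i j) ≡ label i j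
  μ₀-pt {i} {j} i<m j<n = cong₂ label (col-pt j i<m) (row-pt i j<n)

  private
    row<n : ∀ x → row x < n
    row<n x = Fin.toℕ<n (proj₂ x)

    col<m : ∀ x → col x < m
    col<m x = Fin.toℕ<n (proj₁ x)

  ↑-consistent : ∀ x → μ₀ x ≡ ↑ → μ₀ (up x) ≡ ↓
  ↑-consistent x ↑at = by-row (suc (row x) <? n)
    where
      by-row : Dec (suc (row x) < n) → μ₀ (up x) ≡ ↓
      by-row (yes j+1<n) = trans (cong (label (col x)) (toℕ-rowUp (proj₂ x) j+1<n)) (↑-then-↓ (col x) (row x) (≤-pred j+1<n) ↑at)
      by-row (no j+1≮n) = trans (cong (label (col x)) (toℕ-rowUp-top (proj₂ x) j≡n₀))
                                 (↑-at-top (col x) (trans (cong (label (col x)) (sym j≡n₀)) ↑at))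
        where
          j≡n₀ : row x ≡ n₀
          j≡n₀ = suc-injective (≤-antisym (row<n x) (≮⇒≥ j+1≮n))

  ↓-consistent : ∀ x → μ₀ x ≡ ↓ → μ₀ (down x) ≡ ↑
  ↓-consistent x ↓at = by-row (row x) refl
    where
      by-row : ∀ r → row x ≡ r → μ₀ (down x) ≡ ↑
      by-row zero r≡0 = trans (cong (label (col x)) (toℕ-rowDown-0 (proj₂ x) r≡0))
                              (↓-at-bottom (col x) (trans (cong (label (col x)) (sym r≡0)) ↓at))
      by-row (suc j) r≡ = trans (cong (label (col x)) (toℕ-rowDown (proj₂ x) j r≡))
                                (↓-then-↑ (col x) j (≤-pred (subst (_< n) r≡ (row<n x))) (trans (cong (label (col x)) (sym r≡)) ↓at))

  ⇄-consistent-pt : ∀ i j → i < m → j < n → label i j ≡ ⇄ → μ₀ (hor (pt i j)) ≡ ⇄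
  ⇄-consistent-pt i j i<m j<n ⇄at with odd (i + j) in c | suc i <? m
  ... | true | yes i+1<m =
        trans (cong μ₀ (hor-pt-right j i+1<m c)) (trans (μ₀-pt i+1<m j<n) (⇄-right i j c ⇄at))
  ... | true | no i+1≮m with suc-injective (≤-antisym i<m (≮⇒≥ i+1≮m))
  ...   | refl with ⇄-last-column j c ⇄at
  ...     | refl = trans (cong μ₀ (hor-pt-jump 0 refl)) (μ₀-pt (s≤s z≤n) (s≤s (s≤s (s≤s z≤n))))
  ⇄-consistent-pt zero j _ j<n ⇄at | false | _ with ⇄-first-column j c ⇄at
  ... | refl = trans (cong μ₀ (hor-pt-jump-back 0 refl)) (μ₀-pt ≤-refl (s≤s z≤n))
  ⇄-consistent-pt (suc i) j i<m j<n ⇄at | false | _ =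
        trans (cong μ₀ (hor-pt-left j i<m c)) (trans (μ₀-pt (≤-trans (n≤1+n _) i<m) j<n) (⇄-left i j c ⇄at))

  μ₀-consistent : ∀ x → μ₀ (nbr x (μ₀ x)) ≡ opp (μ₀ x)
  μ₀-consistent x with μ₀ x in e
  ... | ↑ = ↑-consistent x e
  ... | ↓ = ↓-consistent x e
  ... | ⇄ = trans (cong (μ₀ ∘ hor) (sym (pt-col-row x)))
                  (⇄-consistent-pt (col x) (row x) (col<m x) (row<n x) e)

  open Steps μ₀

  μ₀-perfect : IsPerfectMatching μ₀
  μ₀-perfect = consistent⇒perfect μ₀-consistent

  -- The hexagon (0 , 1) (0 , 2) (0 , 3) (1 , 3) (1 , 2) (1 , 1) is one cycle of the 2-factor.
  hexagonCell : ℕ → ℕ → Bool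
  hexagonCell 0 1 = true
  hexagonCell 0 2 = true
  hexagonCell 0 3 = true
  hexagonCell 1 1 = true
  hexagonCell 1 2 = true
  hexagonCell 1 3 = true
  hexagonCell _ _ = false

  inHexagon : V → Bool
  inHexagon x = hexagonCell (col x) (row x)

  hexagon-inside : ∀ x → inHexagon x ≡ true →
    inHexagon (nbr x (other₁ (μ₀ x))) ≡ true × inHexagon (nbr x (other₂ (μ₀ x))) ≡ true
  hexagon-inside (0F , 1F) _ = refl , refl
  hexagon-inside (0F , 2F) _ = refl , refl
  hexagon-inside (0F , 3F) _ = refl , refl
  hexagon-inside (1F , 1F) _ = refl , refl
  hexagon-inside (1F , 2F) _ = refl , refl
  hexagon-inside (1F , 3F) _ = refl , refl

  hexagon-connected : ∀ w → inHexagon w ≡ true → Star (Unmatched μ₀) (0F , 1F) w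
  hexagon-connected (0F , 1F) _ = ε
  hexagon-connected (0F , 2F) _ = step (0F , 1F) ↑ (λ ())
  hexagon-connected (0F , 3F) _ = step (0F , 1F) ↑ (λ ()) ◅◅ step (0F , 2F) ↑ (λ ())
  hexagon-connected (1F , 1F) _ = step (0F , 1F) ⇄ (λ ())
  hexagon-connected (1F , 2F) _ = step (0F , 1F) ⇄ (λ ()) ◅◅ step (1F , 1F) ↑ (λ ())
  hexagon-connected (1F , 3F) _ = step (0F , 1F) ⇄ (λ ()) ◅◅ step (1F , 1F) ↑ (λ ()) ◅◅ step (1F , 2F) ↑ (λ ())

  label-lower : ∀ i s → s ≤ b → label i (3 + double s) ≡ middle false i
  label-lower i s s≤b = trans (label-middle i (double s) (<⇒≢ (s≤s (≤-trans (double-mono s≤b) (n≤1+n _)))))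
                              (cong (λ c → middle c i) (odd-double s))

  label-upper : ∀ i s → s ≤ b → label i (4 + double s) ≡ middle true i
  label-upper i s s≤b = trans (label-middle i (suc (double s)) (<⇒≢ (s≤s (s≤s (double-mono s≤b)))))
                              (cong (λ c → middle c i) (cong not (odd-double s)))

  infix 4 _~_
  _~_ : V → V → Set
  x ~ y = Star (Unmatched μ₀) x y

  ~-sym : ∀ {x y} → x ~ y → y ~ x
  ~-sym = reverse (λ {x} {y} → proj₁ (proj₂ (unmatched-2factor {μ₀} μ₀-perfect)) x y)

  up-edge : ∀ {i j} → i ≤ m₀ → j ≤ n₀ → ↑ ≢ label i j → pt i j ~ pt i (suc j)
  up-edge {i} {j} i≤m₀ j≤n₀ ↑≢ =
    subst (pt i j ~_) (up-pt i j) (step (pt i j) ↑ (↑≢ ∘ flip trans (μ₀-pt (s≤s i≤m₀) (s≤s j≤n₀))))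

  right-edge : ∀ {i j} → suc i ≤ m₀ → j ≤ n₀ → odd (i + j) ≡ true → ⇄ ≢ label i j → pt i j ~ pt (suc i) j
  right-edge {i} {j} i<m₀ j≤n₀ odd ⇄≢ =
    subst (pt i j ~_) (hor-pt-right j (s≤s i<m₀) odd)
          (step (pt i j) ⇄ (⇄≢ ∘ flip trans (μ₀-pt (s≤s (≤-trans (n≤1+n _) i<m₀)) (s≤s j≤n₀))))

  jump-edge : ∀ {j} → j ≤ n₀ → odd j ≡ false → ⇄ ≢ label m₀ j → pt m₀ j ~ pt 0 (2 + j)
  jump-edge {j} j≤n₀ even ⇄≢ =
    subst (pt m₀ j ~_) (hor-pt-jump j even) (step (pt m₀ j) ⇄ (⇄≢ ∘ flip trans (μ₀-pt ≤-refl (s≤s j≤n₀))))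

  rail : ∀ {c r r′} → suc c ≤ m₀ → r ≤ n₀ → r′ ≤ n₀ → odd r′ ≡ not (odd r) →
         ⇄ ≢ label c r → ⇄ ≢ label c r′ → pt c r ~ pt (suc c) r ⊎ pt c r′ ~ pt (suc c) r′
  rail {c} {r} {r′} c<m₀ r≤n₀ r′≤n₀ r′-parity ⇄≢r ⇄≢r′ with odd (c + r) in c+r
  ... | true = inj₁ (right-edge c<m₀ r≤n₀ c+r ⇄≢r)
  ... | false = inj₂ (right-edge c<m₀ r′≤n₀ c+r′ ⇄≢r′)
    where
      c+r′ : odd (c + r′) ≡ true
      c+r′ = begin
        odd (c + r′)            ≡⟨ odd-+ c r′ ⟩
        odd c xor odd r′        ≡⟨ cong (odd c xor_) r′-parity ⟩
        odd c xor not (odd r)   ≡⟨ not-distribʳ-xor (odd c) (odd r) ⟨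
        not (odd c xor odd r)   ≡⟨ cong not (odd-+ c r) ⟨
        not (odd (c + r))       ≡⟨ cong not c+r ⟩
        true                    ∎
        where open ≡-Reasoning

  right-block : ∀ {r r′} → r ≤ n₀ → r′ ≤ n₀ → odd r′ ≡ not (odd r) →
    (∀ c → ⇄ ≢ label (3 + c) r) → (∀ c → ⇄ ≢ label (3 + c) r′) → (∀ c → c ≤ double a → pt (3 + c) r ~ pt (3 + c) r′) →
    ∀ c → c ≤ double a → pt 3 r ~ pt (3 + c) r × pt 3 r ~ pt (3 + c) r′
  right-block {r} {r′} r≤n₀ r′≤n₀ r′-parity ⇄≢r ⇄≢r′ column =
    zigzag-connected (λ {x} {y} → proj₁ (proj₂ (unmatched-2factor {μ₀} μ₀-perfect)) x y)
      (λ c → pt (3 + c) r) (λ c → pt (3 + c) r′) (double a) column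
      (λ c c<k → rail (+-monoʳ-≤ 3 c<k) r≤n₀ r′≤n₀ r′-parity (⇄≢r c) (⇄≢r′ c))

  top-edge : ∀ {i} → i ≤ m₀ → ↑ ≢ label i n₀ → pt i n₀ ~ pt i 0
  top-edge {i} i≤m₀ ↑≢ = subst (pt i n₀ ~_) (pt-wrap i) (up-edge i≤m₀ ≤-refl ↑≢)

  private
    ≢-via : ∀ {d e f : Dir} → e ≡ f → d ≢ f → d ≢ e
    ≢-via e≡f d≢f d≡e = d≢f (trans d≡e e≡f)

    lower≤n₀ : ∀ {s} → s ≤ b → 3 + double s ≤ n₀
    lower≤n₀ s≤b = +-monoʳ-≤ 3 (≤-trans (double-mono s≤b) (≤-trans (n≤1+n _) (n≤1+n _)))

    upper≤n₀ : ∀ {s} → s ≤ b → 4 + double s ≤ n₀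
    upper≤n₀ s≤b = +-monoʳ-≤ 4 (≤-trans (double-mono s≤b) (n≤1+n _))

  right-column : ∀ c → c ≤ double a →
    pt (3 + c) n₀ ~ pt (3 + c) 0 × pt (3 + c) n₀ ~ pt (3 + c) 1 × pt (3 + c) n₀ ~ pt (3 + c) 2
  right-column c c≤2a = to-0 , to-1 , to-1 ◅◅ up-edge (+-monoʳ-≤ 3 c≤2a) (s≤s z≤n) (λ ())
    where
      to-0 : pt (3 + c) n₀ ~ pt (3 + c) 0
      to-0 = top-edge (+-monoʳ-≤ 3 c≤2a) (≢-via (label-top (3 + c)) (λ ()))
      to-1 : pt (3 + c) n₀ ~ pt (3 + c) 1
      to-1 = to-0 ◅◅ up-edge (+-monoʳ-≤ 3 c≤2a) z≤n (λ ())

  right-top-rows : ∀ c → c ≤ double a → pt 3 n₀ ~ pt (3 + c) n₀ × pt 3 n₀ ~ pt (3 + c) 2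
  right-top-rows = right-block ≤-refl (s≤s (s≤s z≤n)) (sym (cong not n₀-odd))
    (λ c → ≢-via (label-top (3 + c)) (λ ())) (λ c ()) (λ c c≤2a → proj₂ (proj₂ (right-column c c≤2a)))

  right-middle-rows : ∀ s → s ≤ b → ∀ c → c ≤ double a →
    pt 3 (3 + double s) ~ pt (3 + c) (3 + double s) × pt 3 (3 + double s) ~ pt (3 + c) (4 + double s)
  right-middle-rows s s≤b = right-block (lower≤n₀ s≤b) (upper≤n₀ s≤b) refl
    (λ c → ≢-via (label-lower (3 + c) s s≤b) (λ ())) (λ c → ≢-via (label-upper (3 + c) s s≤b) (λ ()))
    (λ c c≤2a → up-edge (+-monoʳ-≤ 3 c≤2a) (lower≤n₀ s≤b) (≢-via (label-lower (3 + c) s s≤b) (λ ())))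

  private
    odd-5+double : ∀ s → odd (5 + double s) ≡ true
    odd-5+double s = cong (not ∘ not ∘ not ∘ not ∘ not) (odd-double s)

    even-4+double : ∀ s → odd (4 + double s) ≡ false
    even-4+double s = cong (not ∘ not ∘ not ∘ not) (odd-double s)

    ≤b⇒<b⊎≡b : ∀ {s} → s ≤ b → suc s ≤ b ⊎ s ≡ b
    ≤b⇒<b⊎≡b s≤b = m≤n⇒m<n∨m≡n s≤b

  module LeftPair (s : ℕ) (s<b : suc s ≤ b) where
    u l : ℕ
    u = 4 + double s
    l = 5 + double s

    private
      u≤n₀ : u ≤ n₀
      u≤n₀ = upper≤n₀ (≤-trans (n≤1+n s) s<b)
      l≤n₀ : l ≤ n₀
      l≤n₀ = lower≤n₀ s<b
      ↑≢u : ∀ i → i ≤ 2 → ↑ ≢ label i u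
      ↑≢u i i≤2 = ≢-via (label-upper i s (≤-trans (n≤1+n s) s<b)) (lemma i i≤2)
        where
          lemma : ∀ i → i ≤ 2 → ↑ ≢ middle true i
          lemma 0 _ ()
          lemma 1 _ ()
          lemma 2 _ ()
          lemma (suc (suc (suc _))) (s≤s (s≤s ()))
      ⇄≢l : ∀ i → ⇄ ≢ label i l
      ⇄≢l i = ≢-via (label-lower i (suc s) s<b) (middle≢⇄ false i ∘ sym)
      ⇄≢u : ∀ i → ⇄ ≢ label i u
      ⇄≢u i = ≢-via (label-upper i s (≤-trans (n≤1+n s) s<b)) (middle≢⇄ true i ∘ sym)

    to-0l : pt 0 u ~ pt 0 l
    to-0l = up-edge z≤n u≤n₀ (↑≢u 0 z≤n)
    to-1l : pt 0 u ~ pt 1 l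
    to-1l = to-0l ◅◅ right-edge (s≤s z≤n) l≤n₀ (odd-5+double s) (⇄≢l 0)
    to-1u : pt 0 u ~ pt 1 u
    to-1u = to-1l ◅◅ ~-sym (up-edge (s≤s z≤n) u≤n₀ (↑≢u 1 (s≤s z≤n)))
    to-2u : pt 0 u ~ pt 2 u
    to-2u = to-1u ◅◅ right-edge (s≤s (s≤s z≤n)) u≤n₀ (odd-5+double s) (⇄≢u 1)
    to-2l : pt 0 u ~ pt 2 l
    to-2l = to-2u ◅◅ up-edge (s≤s (s≤s z≤n)) u≤n₀ (↑≢u 2 (s≤s (s≤s z≤n)))
    to-3l : pt 0 u ~ pt 3 l
    to-3l = to-2l ◅◅ right-edge (s≤s (s≤s (s≤s z≤n))) l≤n₀ (trans (not-involutive _) (odd-5+double s)) (⇄≢l 2)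

  base : V
  base = pt 2 0

  base~2-1 : base ~ pt 2 1
  base~2-1 = up-edge (s≤s (s≤s z≤n)) z≤n (λ ())

  base~2-2 : base ~ pt 2 2
  base~2-2 = base~2-1 ◅◅ up-edge (s≤s (s≤s z≤n)) (s≤s z≤n) (λ ())

  base~2-3 : base ~ pt 2 3
  base~2-3 = base~2-2 ◅◅ up-edge (s≤s (s≤s z≤n)) (s≤s (s≤s z≤n)) (λ ())

  base~3-3 : base ~ pt 3 3
  base~3-3 = base~2-3 ◅◅ right-edge (s≤s (s≤s (s≤s z≤n))) (s≤s (s≤s (s≤s z≤n))) refl (λ ())

  base~1-0 : base ~ pt 1 0
  base~1-0 = ~-sym (right-edge (s≤s (s≤s z≤n)) z≤n refl (λ ()))

  base~1-top : base ~ pt 1 n₀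
  base~1-top = base~1-0 ◅◅ ~-sym (top-edge (s≤s z≤n) (≢-via (label-top 1) (λ ())))

  base~1-upper : base ~ pt 1 (4 + double b)
  base~1-upper = base~1-top ◅◅ ~-sym (up-edge (s≤s z≤n) (upper≤n₀ ≤-refl) (≢-via (label-upper 1 b ≤-refl) (λ ())))

  base~2-upper : base ~ pt 2 (4 + double b)
  base~2-upper = base~1-upper ◅◅
    right-edge (s≤s (s≤s z≤n)) (upper≤n₀ ≤-refl) (odd-5+double b) (≢-via (label-upper 1 b ≤-refl) (λ ()))

  base~2-top : base ~ pt 2 n₀
  base~2-top = base~2-upper ◅◅ up-edge (s≤s (s≤s z≤n)) (upper≤n₀ ≤-refl) (≢-via (label-upper 2 b ≤-refl) (λ ()))

  base~3-top : base ~ pt 3 n₀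
  base~3-top = base~2-top ◅◅
    right-edge (s≤s (s≤s (s≤s z≤n))) ≤-refl (trans (not-involutive _) n₀-odd) (≢-via (label-top 2) (λ ()))

  jump-upper : ∀ s → s ≤ b → pt m₀ (4 + double s) ~ pt 0 (6 + double s)
  jump-upper s s≤b = jump-edge (upper≤n₀ s≤b) (even-4+double s) (≢-via (label-upper m₀ s s≤b) (λ ()))

  base~right-lower : ∀ s → s ≤ b → base ~ pt 3 (3 + double s)
  base~left-upper : ∀ s → suc s ≤ b → base ~ pt 0 (4 + double s)
  base~right-lower zero _ = base~3-3
  base~right-lower (suc s) s<b = base~left-upper s s<b ◅◅ LeftPair.to-3l s s<b
  base~left-upper zero _ =
    base~3-top ◅◅ proj₂ (right-top-rows (double a) ≤-refl) ◅◅ jump-edge (s≤s (s≤s z≤n)) refl (λ ())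
  base~left-upper (suc s) s+1<b =
    base~right-lower s s≤b ◅◅ proj₂ (right-middle-rows s s≤b (double a) ≤-refl) ◅◅ jump-upper s s≤b
    where
      s≤b : s ≤ b
      s≤b = ≤-trans (n≤1+n s) (≤-trans (n≤1+n (suc s)) s+1<b)

  base~0-0 : base ~ pt 0 0
  base~0-0 = subst (base ~_) (pt-wrap 0)
    (base~right-lower b ≤-refl ◅◅ proj₂ (right-middle-rows b ≤-refl (double a) ≤-refl) ◅◅ jump-upper b ≤-refl)

  base~0-top : base ~ pt 0 n₀
  base~0-top = base~0-0 ◅◅ ~-sym (top-edge z≤n (≢-via (label-top 0) (λ ())))

  base~0-upper : base ~ pt 0 (4 + double b)
  base~0-upper = base~0-top ◅◅ ~-sym (up-edge z≤n (upper≤n₀ ≤-refl) (≢-via (label-upper 0 b ≤-refl) (λ ())))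

  data Row : ℕ → Set where
    row-0 : Row 0
    row-1 : Row 1
    row-2 : Row 2
    lower : ∀ s → s ≤ b → Row (3 + double s)
    upper : ∀ s → s ≤ b → Row (4 + double s)
    top : Row n₀

  row-view : ∀ j → j ≤ n₀ → Row j
  row-view 0 _ = row-0
  row-view 1 _ = row-1
  row-view 2 _ = row-2
  row-view (suc (suc (suc k))) k≤ with parity-split k
  ... | s , inj₂ refl = upper s (double-cancel (≤-pred (≤-pred (≤-pred (≤-pred k≤)))))
  ... | s , inj₁ refl with m≤n⇒m<n∨m≡n (double-cancel {s} {suc b} (≤-trans (≤-pred (≤-pred (≤-pred k≤))) (n≤1+n _)))
  ...   | inj₁ s<b+1 = lower s (≤-pred s<b+1)
  ...   | inj₂ refl = top

  base~right : ∀ c {j} → c ≤ double a → Row j → base ~ pt (3 + c) j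
  base~right c c≤2a row-0 = base~3-top ◅◅ proj₁ (right-top-rows c c≤2a) ◅◅ proj₁ (right-column c c≤2a)
  base~right c c≤2a row-1 = base~3-top ◅◅ proj₁ (right-top-rows c c≤2a) ◅◅ proj₁ (proj₂ (right-column c c≤2a))
  base~right c c≤2a row-2 = base~3-top ◅◅ proj₂ (right-top-rows c c≤2a)
  base~right c c≤2a (lower s s≤b) = base~right-lower s s≤b ◅◅ proj₁ (right-middle-rows s s≤b c c≤2a)
  base~right c c≤2a (upper s s≤b) = base~right-lower s s≤b ◅◅ proj₂ (right-middle-rows s s≤b c c≤2a)
  base~right c c≤2a top = base~3-top ◅◅ proj₁ (right-top-rows c c≤2a)

  base~left : ∀ i {j} → i ≤ 2 → hexagonCell i j ≡ false → Row j → base ~ pt i j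
  base~left 2 _ _ row-0 = ε
  base~left 2 _ _ row-1 = base~2-1
  base~left 2 _ _ row-2 = base~2-2
  base~left 2 _ _ (lower zero _) = base~2-3
  base~left 2 _ _ (lower (suc s) s<b) = base~left-upper s s<b ◅◅ LeftPair.to-2l s s<b
  base~left 2 _ _ (upper s s≤b) with ≤b⇒<b⊎≡b s≤b
  ... | inj₁ s<b = base~left-upper s s<b ◅◅ LeftPair.to-2u s s<b
  ... | inj₂ refl = base~2-upper
  base~left 2 _ _ top = base~2-top
  base~left 1 _ _ row-0 = base~1-0
  base~left 1 _ _ (lower (suc s) s<b) = base~left-upper s s<b ◅◅ LeftPair.to-1l s s<b
  base~left 1 _ _ (upper s s≤b) with ≤b⇒<b⊎≡b s≤b
  ... | inj₁ s<b = base~left-upper s s<b ◅◅ LeftPair.to-1u s s<b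
  ... | inj₂ refl = base~1-upper
  base~left 1 _ _ top = base~1-top
  base~left 0 _ _ row-0 = base~0-0
  base~left 0 _ _ (lower (suc s) s<b) = base~left-upper s s<b ◅◅ LeftPair.to-0l s s<b
  base~left 0 _ _ (upper s s≤b) with ≤b⇒<b⊎≡b s≤b
  ... | inj₁ s<b = base~left-upper s s<b
  ... | inj₂ refl = base~0-upper
  base~left 0 _ _ top = base~0-top
  base~left (suc (suc (suc _))) (s≤s (s≤s ())) _ _

  base~ : ∀ i {j} → i < m → hexagonCell i j ≡ false → Row j → base ~ pt i j
  base~ 0 _ = base~left 0 z≤n
  base~ 1 _ = base~left 1 (s≤s z≤n)
  base~ 2 _ = base~left 2 (s≤s (s≤s z≤n))
  base~ (suc (suc (suc c))) i<m _ = base~right c (≤-pred (≤-pred (≤-pred (≤-pred i<m))))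

  outside-connected : ∀ w → inHexagon w ≡ false → base ~ w
  outside-connected w outside = subst (base ~_) (pt-col-row w)
    (base~ (col w) (Fin.toℕ<n (proj₁ w)) outside (row-view (row w) (≤-pred (Fin.toℕ<n (proj₂ w)))))

  hexagon-separates : ∀ {u v} → inHexagon u ≢ inHexagon v → Separating2Factor Adjacent u v
  hexagon-separates = unmatched-separating μ₀-perfect inHexagon
    (closed-from-inside μ₀-perfect inHexagon hexagon-inside) side-base connected
    where
      side-base : Bool → V
      side-base true = 0F , 1F
      side-base false = base
      connected : ∀ w → Star (Unmatched μ₀) (side-base (inHexagon w)) w
      connected w with inHexagon w in e
      ... | true = hexagon-connected w e
      ... | false = outside-connected w e

  splits-1-3 : ∀ y → y ≢ pt 1 3 → Splits inHexagon (pt 1 3) y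
  splits-1-3 y y≢ with inHexagon y in e
  ... | false = identity , λ t≡ → contradiction (trans t≡ e) λ ()
  ... | true = in-hexagon y e y≢
    where
      in-hexagon : ∀ y → inHexagon y ≡ true → y ≢ pt 1 3 → Splits inHexagon (pt 1 3) y
      in-hexagon (0F , 1F) _ _ = shift² , λ ()
      in-hexagon (0F , 2F) _ _ = shift² , λ ()
      in-hexagon (0F , 3F) _ _ = diagonal , λ ()
      in-hexagon (1F , 1F) _ _ = shift² , λ ()
      in-hexagon (1F , 2F) _ _ = shift² , λ ()
      in-hexagon (1F , 3F) _ y≢ = contradiction refl y≢

  splits-1-4 : ∀ y → y ≢ pt 1 4 → Splits inHexagon (pt 1 4) y
  splits-1-4 y y≢ with inHexagon (from shift² y) in e
  ... | false = shift² , λ t≡ → contradiction (trans t≡ e) λ ()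
  ... | true = two-above-hexagon y e y≢
    where
      two-above-hexagon : ∀ y → inHexagon (from shift² y) ≡ true → y ≢ pt 1 4 → Splits inHexagon (pt 1 4) y
      two-above-hexagon (0F , 3F) _ _ = diagonal , λ ()
      two-above-hexagon (0F , 4F) _ _ = diagonal , λ ()
      two-above-hexagon (0F , 5F) _ _ = diagonal , λ ()
      two-above-hexagon (1F , 3F) _ _ = diagonal ∘ₛ shift² , λ ()
      two-above-hexagon (1F , 4F) _ y≢ = contradiction refl y≢
      two-above-hexagon (1F , 5F) _ _ = diagonal , λ ()

  two-spanning-cyclable : HTG-2SC (4 + double a) (6 + double b) 2
  two-spanning-cyclable = two-spanning-cyclable-by-splitting inHexagon hexagon-separates splits-1-3 splits-1-4

even-double : ∀ k → k % 2 ≡ 0 → ∃ λ s → double s ≡ k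
even-double k k%2≡0 with parity-split k
... | s , inj₁ refl = s , refl
... | s , inj₂ refl = contradiction (trans (sym (cong not (odd-double s))) (%2≡0⇒even k k%2≡0)) λ ()

HTG-2SC-classification : ∀ a b →
  HTG-2SC (2 + double a) (4 + double b) 2 ⇔ ((2 + double a ≡ 2 × 4 + double b ≡ 4) ⊎ (4 ≤ 2 + double a × 6 ≤ 4 + double b))
HTG-2SC-classification zero zero = mk⇔ (λ _ → inj₁ (refl , refl)) (λ _ → HTG-2-4.two-spanning-cyclable)
HTG-2SC-classification zero (suc b) =
  mk⇔ (⊥-elim ∘ TwoColumns.not-two-spanning-cyclable b) λ { (inj₁ (_ , ())) ; (inj₂ (s≤s (s≤s ()) , _)) }
HTG-2SC-classification (suc a) zero =
  mk⇔ (⊥-elim ∘ FourRows.not-two-spanning-cyclable a) λ { (inj₁ (() , _)) ; (inj₂ (_ , s≤s (s≤s (s≤s (s≤s ()))))) }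
HTG-2SC-classification (suc a) (suc b) =
  mk⇔ (λ _ → inj₂ (m≤m+n 4 (double a) , m≤m+n 6 (double b))) (λ _ → Large.two-spanning-cyclable a b)

theorem5p2 : (m n : ℕ) → 2 ≤ m → m % 2 ≡ 0 → 4 ≤ n → n % 2 ≡ 0 →
    HTG-2SC m n 2 ⇔ ((m ≡ 2 × n ≡ 4) ⊎ (4 ≤ m × 6 ≤ n))
theorem5p2 (suc (suc m′)) (suc (suc (suc (suc n′)))) (s≤s (s≤s _)) m-even (s≤s (s≤s (s≤s (s≤s _)))) n-even
  with even-double m′ m-even | even-double n′ n-even
... | a , refl | b , refl = HTG-2SC-classification a b
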